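{- Let $K=\mathbf{Q}(\sqrt{ -3})$, $\omega=\exp(2\pi i/3)$, $\mathcal{O}=\mathbf{Z}[\omega]$, $\lambda=\omega-\omega^2=\sqrt{ -3}$, and for $\alpha\in K$ let $T(\alpha)=\alpha+\overline{\alpha}$. For $\alpha\in\mathcal{O}$ let $\chi(\alpha)=\omega^a$, where $a\in\mathbf{Z}$ satisfies $\alpha\equiv a\pmod{\lambda\mathcal{O}}$. For integers $k$ define the formal series $$a(q,z,w)=\sum_{\alpha\in\mathcal{O}}q^{|\alpha|^2}z^{T(\alpha)}w^{T(\alpha/\lambda)},\qquad b_k(q,z,w)=\sum_{\alpha\in\mathcal{O}}\chi(\alpha)^kq^{|\alpha|^2}z^{T(\alpha)}w^{T(\alpha/\lambda)},$$ $$c_k(q,z,w)=\sum_{\alpha\in\mathcal{O}+k/\lambda}q^{|\alpha|^2}z^{T(\alpha)}w^{T(\alpha/\lambda)},$$ and set $a(q)=a(q,1,1)$, $b(q)=b_1(q,1,1)$, $c(q)=c_1(q,1,1)$. Then for each integer $k$, $$3c_k(q,z,w)c_k(q^2,z^2,w^2)=a(q,w,z^{ -3})a(q^2)+\omega^k b_1(q,w,z^{ -3})b(q^2)+\omega^{ -k}b_{ -1}(q,w,z^{ -3})b(q^2)+c_1(q,w,z^{ -3})c(q^2)+c_{ -1}(q,w,z^{ -3})c(q^2).$$ In particular $$3a(q,z,w)a(q^2,z^2,w^2)=a(q,w,z^{ -3})a(q^2)+b_1(q,w,z^{ -3})b(q^2)+b_{ -1}(q,w,z^{ -3})b(q^2)+c_1(q,w,z^{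 -3})c(q^2)+c_{ -1}(q,w,z^{ -3})c(q^2).$$
   Context: $\chi$ is well defined since $\mathbf{Z}\to\mathcal{O}$ induces an isomorphism $\mathbf{Z}/3\mathbf{Z}\cong\mathcal{O}/\lambda\mathcal{O}$. The series are formal series in $q,z,w$ with rational exponents; e.g. $a(q,w,z^{ -3})$ denotes $\sum_{\alpha\in\mathcal{O}}q^{|\alpha|^2}w^{T(\alpha)}z^{ -3T(\alpha/\lambda)}$, and $c_k(q^2,z^2,w^2)$ is obtained by substituting $q^2,z^2,w^2$ for $q,z,w$. Note $c_0=a$, $b_0=a$, and $b_k,c_k$ depend only on $k$ mod $3$. -}

module Defs where

open import Data.Nat as ℕ using (ℕ)
open import Data.Integer as ℤ using (ℤ; +_)
open import Data.Integer.DivMod using (_%ℕ_)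
open import Data.Rational as ℚ using (ℚ; 0ℚ; 1ℚ)
open import Data.Product using (_×_; _,_; proj₁; proj₂)
open import Data.List using (List; []; _∷_; map; upTo; cartesianProduct; foldr)
open import Relation.Nullary using (yes; no)
open import Data.Bool using (Bool; true; false; _∧_; if_then_else_)
open import Relation.Nullary.Decidable using (⌊_⌋)

-- The field K = Q(sqrt -3), an element (a , b) standing for a + b ω,
-- where ω = exp(2πi/3), so ω² = -1 - ω.

K : Set
K = ℚ × ℚ

ℤ→ℚ : ℤ → ℚ
ℤ→ℚ n = n ℚ./ 1

infixl 6 _+K_
infixl 7 _*K_

_+K_ : K → K → K
(a , b) +K (c , d) = (a ℚ.+ c , b ℚ.+ d)

-- (a + bω)(c + dω) = ac + (ad + bc) ω + bd ω² = (ac - bd) + (ad + bc - bd) ω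
_*K_ : K → K → K
(a , b) *K (c , d) = (a ℚ.* c ℚ.- b ℚ.* d , (a ℚ.* d ℚ.+ b ℚ.* c) ℚ.- b ℚ.* d)

0K 1K ωK : K
0K = (0ℚ , 0ℚ)
1K = (1ℚ , 0ℚ)
ωK = (0ℚ , 1ℚ)

fromℚ : ℚ → K
fromℚ r = (r , 0ℚ)

-- complex conjugation: conj ω = ω² = -1 - ω, so conj (a + bω) = (a - b) - bω
conj : K → K
conj (a , b) = (a ℚ.- b , ℚ.- b)

-- λ = ω - ω² = 1 + 2ω  (= sqrt -3)
λK : K
λK = (1ℚ , ℤ→ℚ (+ 2))

-- 1/λ = conj λ / 3 = (-1 - 2ω)/3
λK⁻¹ : K
λK⁻¹ = (ℤ.- (+ 1) ℚ./ 3 , ℤ.- (+ 2) ℚ./ 3)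

-- T(α) = α + conj α  (lies in Q; we take its rational part)
T : K → ℚ
T α = proj₁ (α +K conj α)

-- |α|² = α · conj α  (lies in Q; we take its rational part)
normSq : K → ℚ
normSq α = proj₁ (α *K conj α)

O : Set
O = ℤ × ℤ

ι : O → K
ι (x , y) = (ℤ→ℚ x , ℤ→ℚ y)

ωpow : ℤ → K
ωpow n with n %ℕ 3
... | 0 = 1K
... | 1 = ωK
... | _ = ωK *K ωK

-- χ(α)^k, where χ(α) = ω^a with α ≡ a (mod λO).
-- For α = x + yω we have α - (x + y) = y(ω - 1) = -yω²λ ∈ λO,
-- so a = x + y works, and χ(α)^k = ω^(k a).
χ^ : ℤ → O → K
χ^ k (x , y) = ωpow (k ℤ.* (x ℤ.+ y))

-- Formal series in q, z, w with rational exponents, presented as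
--   Σ_{β ∈ O} coef β · q^(e₁ β) z^(e₂ β) w^(e₃ β).

Mono : Set
Mono = ℚ × ℚ × ℚ

record Series : Set where
  constructor mkSeries
  field
    coef : O → K
    expo : O → Mono
open Series public

-- The basic theta-type series
--   Σ_{α ∈ O + s} f(α - s) q^{|α|²} z^{T(α)} w^{T(α/λ)}
theta : K → (O → K) → Series
theta s f = mkSeries f (λ β → let α = ι β +K s in
                          (normSq α , T α , T (α *K λK⁻¹)))

aS : Series
aS = theta 0K (λ _ → 1K)

bS : ℤ → Series
bS k = theta 0K (χ^ k)

cS : ℤ → Series
cS k = theta (fromℚ (ℤ→ℚ k) *K λK⁻¹) (λ _ → 1K)

substExp : (Mono → Mono) → Series → Series
substExp σ S = mkSeries (coef S) (λ β → σ (expo S β))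

-- (q,z,w) ↦ (q, w, z^{-3}) : q^e₁ z^e₂ w^e₃ ↦ q^e₁ z^(-3 e₃) w^e₂
σ-wz : Mono → Mono
σ-wz (e₁ , e₂ , e₃) = (e₁ , ℚ.- (ℤ→ℚ (+ 3) ℚ.* e₃) , e₂)

σ-sq : Mono → Mono
σ-sq (e₁ , e₂ , e₃) = (ℤ→ℚ (+ 2) ℚ.* e₁ , ℤ→ℚ (+ 2) ℚ.* e₂ , ℤ→ℚ (+ 2) ℚ.* e₃)

σ-sq11 : Mono → Mono
σ-sq11 (e₁ , e₂ , e₃) = (ℤ→ℚ (+ 2) ℚ.* e₁ , 0ℚ , 0ℚ)

range : ℕ → List ℤ
range R = map (λ i → + i ℤ.- + R) (upTo (ℕ.suc (2 ℕ.* R)))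

box : ℕ → List O
box R = cartesianProduct (range R) (range R)

sumK : List K → K
sumK = foldr _+K_ 0K

_+M_ : Mono → Mono → Mono
(a , b , c) +M (d , e , f) = (a ℚ.+ d , b ℚ.+ e , c ℚ.+ f)

_≟M_ : Mono → Mono → Bool
(a , b , c) ≟M (d , e , f) = ⌊ a ℚ.≟ d ⌋ ∧ ⌊ b ℚ.≟ e ⌋ ∧ ⌊ c ℚ.≟ f ⌋

-- As R grows this stabilises to the
-- coefficient of m in the product S · S' (all q-exponents are ≥ 0 and
-- each q-exponent is attained by finitely many terms).
prodCoefR : ℕ → Series → Series → Mono → K
prodCoefR R S S' m =
  sumK (map (λ β → sumK (map (λ γ →
     if (expo S β +M expo S' γ) ≟M m then coef S β *K coef S' γ else 0K)
     (box R))) (box R))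

{-# OPTIONS --safe #-}
module Submission where

-- Both sides are sums over pairs (U , V) of lattice points, each pair carrying the monomial
-- q^((|U|² + 2|V|²)/3) z^(T U) w^(T (U/λ)).  On the left, (α , α′) ↦ (α + 2α′ , α − α′) maps
-- (O + k/λ)² bijectively onto the pairs in O² with U − V + kλ ∈ 3O; on the right,
-- (α , α′) ↦ (λα , λα′) maps (O + j/λ) × (O + j′/λ) onto the pairs with U ≡ j and V ≡ j′
-- modulo λ.  So the coefficient of a monomial on either side is a weighted count of the finitely
-- many pairs (U , V) carrying it, and multiplying V by a unit of O permutes these pairs.
-- Averaging the weights over the six units therefore changes neither count, and the averaged
-- weights depend only on U, V and k modulo 3, where they agree on all 3⁵ residue classes.

open import Defs
open import Data.Nat using (ℕ; _≤_)
open import Data.Integer using (ℤ; +_; -_)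
open import Data.Product using (_×_; ∃)
open import Relation.Binary.PropositionalEquality using (_≡_)

open import Algebra.Bundles using (CommutativeRing; CommutativeSemiring)
open import Algebra.Structures {A = K} _≡_ using (IsCommutativeRing)
open import Data.Bool using (Bool; true; false; _∧_; if_then_else_)
open import Data.Empty using (⊥-elim)
open import Data.Integer as ℤ using (-[1+_]; ∣_∣; _⊖_)
open import Data.Integer.DivMod using (_%ℕ_; _/ℕ_; n%ℕd<d; a≡a%ℕn+[a/ℕn]*n)
import Data.Integer.Properties as ℤP
open import Algebra.Properties.AbelianGroup ℤP.+-0-abelianGroup using () renaming (∙-cancelʳ to +-cancelʳ)
open import Data.Integer.Tactic.RingSolver using () renaming (ring to ℤ-ring)
open import Data.List using (List; []; _∷_; map; foldr; _++_; upTo; cartesianProduct)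
open import Data.List.Membership.Propositional using (_∈_)
import Data.List.Membership.Propositional.Properties as ∈
open import Data.List.Relation.Unary.All as All using (All; []; _∷_; all?)
open import Data.List.Relation.Unary.AllPairs using ([]; _∷_)
open import Data.List.Relation.Unary.Any using (here; there)
open import Data.List.Relation.Unary.Unique.Propositional using (Unique)
import Data.List.Relation.Unary.Unique.Propositional.Properties as Unique
open import Data.Maybe using (Maybe; just; nothing)
open import Data.Nat as ℕ using (zero; suc; _<_; s≤s; z≤n)
import Data.Nat.Coprimality as Coprimality
import Data.Nat.Properties as ℕP
open import Data.Product using (_,_; proj₁; proj₂)
open import Data.Product.Properties using (≡-dec)
open import Data.Rational as ℚ using (ℚ; 0ℚ; 1ℚ; mkℚ; ↥_)
import Data.Rational.Properties as ℚP
open import Level using (Level; 0ℓ)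
open import Relation.Binary.Definitions using (DecidableEquality)
import Relation.Binary.PropositionalEquality as ≡
open import Relation.Nullary using (¬_; Dec; yes; no)
open import Relation.Nullary.Decidable using (⌊_⌋; toWitness)
open import Tactic.RingSolver using (solve-∀)
open import Tactic.RingSolver.Core.AlmostCommutativeRing using (AlmostCommutativeRing; fromCommutativeRing)

record Reindexing (A B : Set) : Set where
  field
    to       : A → B
    from     : B → A
    image    : B → Bool
    to-image : ∀ a → image (to a) ≡ true
    from-to  : ∀ a → from (to a) ≡ a
    to-from  : ∀ b → image b ≡ true → to (from b) ≡ b

module ListSum {c ℓ : Level} (R : CommutativeSemiring c ℓ) where

  open CommutativeSemiring R
  open import Relation.Binary.Reasoning.Setoid setoid
  open import Algebra.Properties.CommutativeSemigroup +-commutativeSemigroup using (interchange)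

  ∑ : {A : Set} → List A → (A → Carrier) → Carrier
  ∑ L f = foldr _+_ 0# (map f L)

  syntax ∑ L (λ x → e) = ∑[ x ∈ L ] e

  module _ {A : Set} where

    ∑-cong : (L : List A) {f g : A → Carrier} → (∀ x → f x ≈ g x) → ∑ L f ≈ ∑ L g
    ∑-cong []       f≈g = refl
    ∑-cong (x ∷ xs) f≈g = +-cong (f≈g x) (∑-cong xs f≈g)

    ∑-zero : (L : List A) {f : A → Carrier} → (∀ x → f x ≈ 0#) → ∑ L f ≈ 0#
    ∑-zero []       f≈0 = refl
    ∑-zero (x ∷ xs) f≈0 = trans (+-cong (f≈0 x) (∑-zero xs f≈0)) (+-identityˡ 0#)

    ∑-+ : (L : List A) (f g : A → Carrier) → ∑[ x ∈ L ] (f x + g x) ≈ ∑ L f + ∑ L g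
    ∑-+ []       f g = sym (+-identityˡ 0#)
    ∑-+ (x ∷ xs) f g = trans (+-cong refl (∑-+ xs f g)) (interchange (f x) (g x) (∑ xs f) (∑ xs g))

    ∑-*ˡ : (L : List A) (a : Carrier) (f : A → Carrier) → a * ∑ L f ≈ ∑[ x ∈ L ] (a * f x)
    ∑-*ˡ []       a f = zeroʳ a
    ∑-*ˡ (x ∷ xs) a f = trans (distribˡ a (f x) (∑ xs f)) (+-cong refl (∑-*ˡ xs a f))

    ∑-++ : (xs ys : List A) (f : A → Carrier) → ∑ (xs ++ ys) f ≈ ∑ xs f + ∑ ys f
    ∑-++ []       ys f = sym (+-identityˡ _)
    ∑-++ (x ∷ xs) ys f = trans (+-cong refl (∑-++ xs ys f)) (sym (+-assoc (f x) _ _))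

    ∑-map : {B : Set} (L : List B) (h : B → A) (f : A → Carrier) → ∑ (map h L) f ≈ ∑[ x ∈ L ] f (h x)
    ∑-map []       h f = refl
    ∑-map (x ∷ xs) h f = +-cong refl (∑-map xs h f)

  module _ {A B : Set} where

    ∑-comm : (L₁ : List A) (L₂ : List B) (g : A → B → Carrier) →
             ∑[ a ∈ L₁ ] ∑[ b ∈ L₂ ] g a b ≈ ∑[ b ∈ L₂ ] ∑[ a ∈ L₁ ] g a b
    ∑-comm []       L₂ g = sym (∑-zero L₂ (λ _ → refl))
    ∑-comm (a ∷ as) L₂ g = begin
      ∑ L₂ (g a) + ∑[ a′ ∈ as ] ∑ L₂ (g a′)           ≈⟨ +-cong refl (∑-comm as L₂ g) ⟩
      ∑ L₂ (g a) + ∑[ b ∈ L₂ ] ∑[ a′ ∈ as ] g a′ b     ≈⟨ ∑-+ L₂ (g a) _ ⟨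
      ∑[ b ∈ L₂ ] (g a b + ∑[ a′ ∈ as ] g a′ b)         ∎

    ∑-cartesianProduct : (L₁ : List A) (L₂ : List B) (f : A × B → Carrier) →
                         ∑ (cartesianProduct L₁ L₂) f ≈ ∑[ a ∈ L₁ ] ∑[ b ∈ L₂ ] f (a , b)
    ∑-cartesianProduct []       L₂ f = refl
    ∑-cartesianProduct (a ∷ as) L₂ f =
      trans (∑-++ (map (a ,_) L₂) (cartesianProduct as L₂) f)
            (+-cong (∑-map L₂ (a ,_) f) (∑-cartesianProduct as L₂ f))

  module _ {A : Set} (_≟_ : DecidableEquality A) where

    ∑-indicator-∉ : (L : List A) (p : A) (g : A → Carrier) → All (λ y → ¬ p ≡ y) L →
                    ∑[ x ∈ L ] (if ⌊ x ≟ p ⌋ then g x else 0#) ≈ 0#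
    ∑-indicator-∉ []       p g []         = refl
    ∑-indicator-∉ (y ∷ ys) p g (p≢y ∷ ps) with y ≟ p
    ... | yes y≡p = ⊥-elim (p≢y (≡.sym y≡p))
    ... | no  _   = trans (+-identityˡ _) (∑-indicator-∉ ys p g ps)

    ∑-indicator : (L : List A) (p : A) (g : A → Carrier) → Unique L → p ∈ L →
                  ∑[ x ∈ L ] (if ⌊ x ≟ p ⌋ then g x else 0#) ≈ g p
    ∑-indicator (y ∷ ys) p g (y∉ys ∷ _) (here ≡.refl) with y ≟ y
    ... | yes _   = trans (+-cong refl (∑-indicator-∉ ys y g y∉ys)) (+-identityʳ (g y))
    ... | no  y≢y = ⊥-elim (y≢y ≡.refl)
    ∑-indicator (y ∷ ys) p g (y∉ys ∷ u) (there p∈ys) with y ≟ p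
    ... | yes ≡.refl = ⊥-elim (All.lookup y∉ys p∈ys ≡.refl)
    ... | no  _      = trans (+-identityˡ _) (∑-indicator ys p g u p∈ys)

  module _ {A B : Set} (_≟A_ : DecidableEquality A) (_≟B_ : DecidableEquality B)
           (r : Reindexing A B) where

    open Reindexing r

    -- Both sides are the double sum of [ b ≡ to a ] f b over a ∈ L₁ and b ∈ L₂.
    ∑-reindex : (L₁ : List A) (L₂ : List B) → Unique L₁ → Unique L₂ →
                (f : B → Carrier) (S : B → Bool) → (∀ b → S b ≡ false → f b ≈ 0#) →
                (∀ a → S (to a) ≡ true → to a ∈ L₂) →
                (∀ b → image b ≡ true → S b ≡ true → from b ∈ L₁) →
                ∑[ a ∈ L₁ ] f (to a) ≈ ∑[ b ∈ L₂ ] (if image b then f b else 0#)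
    ∑-reindex L₁ L₂ u₁ u₂ f S f-supp to∈L₂ from∈L₁ = begin
      ∑[ a ∈ L₁ ] f (to a)                                          ≈⟨ ∑-cong L₁ expand ⟩
      ∑[ a ∈ L₁ ] ∑[ b ∈ L₂ ] (if ⌊ b ≟B to a ⌋ then f b else 0#)   ≈⟨ ∑-comm L₁ L₂ _ ⟩
      ∑[ b ∈ L₂ ] ∑[ a ∈ L₁ ] (if ⌊ b ≟B to a ⌋ then f b else 0#)   ≈⟨ ∑-cong L₂ collapse ⟩
      ∑[ b ∈ L₂ ] (if image b then f b else 0#)                     ∎
      where
      vanishes : ∀ {b} → S b ≡ false → ∀ t → (if t then f b else 0#) ≈ 0#
      vanishes Sb≡false true  = f-supp _ Sb≡false
      vanishes Sb≡false false = refl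

      expand : ∀ a → f (to a) ≈ ∑[ b ∈ L₂ ] (if ⌊ b ≟B to a ⌋ then f b else 0#)
      expand a with S (to a) in eq
      ... | true  = sym (∑-indicator _≟B_ L₂ (to a) f u₂ (to∈L₂ a eq))
      ... | false = trans (f-supp (to a) eq) (sym (∑-zero L₂ zero-term))
        where
        zero-term : ∀ b → (if ⌊ b ≟B to a ⌋ then f b else 0#) ≈ 0#
        zero-term b with b ≟B to a
        ... | yes ≡.refl = vanishes eq true
        ... | no  _      = refl

      same-test : ∀ b → image b ≡ true → ∀ a → ⌊ b ≟B to a ⌋ ≡ ⌊ a ≟A from b ⌋
      same-test b img a with b ≟B to a | a ≟A from b
      ... | yes _      | yes _      = ≡.refl
      ... | no  _      | no  _      = ≡.refl
      ... | yes ≡.refl | no  a≢     = ⊥-elim (a≢ (≡.sym (from-to a)))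
      ... | no  b≢     | yes ≡.refl = ⊥-elim (b≢ (≡.sym (to-from b img)))

      collapse : ∀ b → ∑[ a ∈ L₁ ] (if ⌊ b ≟B to a ⌋ then f b else 0#) ≈ (if image b then f b else 0#)
      collapse b with image b in img
      ... | false = ∑-zero L₁ zero-term
        where
        zero-term : ∀ a → (if ⌊ b ≟B to a ⌋ then f b else 0#) ≈ 0#
        zero-term a with b ≟B to a
        ... | yes ≡.refl with () ← ≡.trans (≡.sym img) (to-image a)
        ... | no  _      = refl
      ... | true with S b in Sb
      ...   | false = trans (∑-zero L₁ (λ a → vanishes Sb _)) (sym (f-supp b Sb))
      ...   | true  = begin
        ∑[ a ∈ L₁ ] (if ⌊ b ≟B to a ⌋ then f b else 0#)
          ≈⟨ ∑-cong L₁ (λ a → reflexive (≡.cong (λ t → if t then f b else 0#) (same-test b img a))) ⟩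
        ∑[ a ∈ L₁ ] (if ⌊ a ≟A from b ⌋ then f b else 0#)
          ≈⟨ ∑-indicator _≟A_ L₁ (from b) (λ _ → f b) u₁ (from∈L₁ b img Sb) ⟩
        f b ∎

-- Opened only now, since ListSum uses the refl, sym and trans of its semiring.
open ≡ using (refl; sym; trans; cong; cong₂; subst; module ≡-Reasoning)

ℚ-ring : AlmostCommutativeRing 0ℓ 0ℓ
ℚ-ring = fromCommutativeRing ℚP.+-*-commutativeRing isZero
  where
  isZero : (x : ℚ) → Maybe (0ℚ ≡ x)
  isZero x with x ℚP.≟ 0ℚ
  ... | yes x≡0 = just (sym x≡0)
  ... | no  _   = nothing

-K_ : K → K
-K (a , b) = (ℚ.- a , ℚ.- b)

module _ where
  open import Data.Rational using (_+_; _*_; _-_)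

  +K-assoc : ∀ x y z → (x +K y) +K z ≡ x +K (y +K z)
  +K-assoc (a , b) (c , d) (e , f) = cong₂ _,_ (assoc a c e) (assoc b d f)
    where
    assoc : ∀ a c e → (a + c) + e ≡ a + (c + e)
    assoc = solve-∀ ℚ-ring

  +K-comm : ∀ x y → x +K y ≡ y +K x
  +K-comm (a , b) (c , d) = cong₂ _,_ (comm a c) (comm b d)
    where
    comm : ∀ a c → a + c ≡ c + a
    comm = solve-∀ ℚ-ring

  +K-identityˡ : ∀ x → 0K +K x ≡ x
  +K-identityˡ (a , b) = cong₂ _,_ (identity a) (identity b)
    where
    identity : ∀ a → 0ℚ + a ≡ a
    identity = solve-∀ ℚ-ring

  +K-inverseˡ : ∀ x → (-K x) +K x ≡ 0K
  +K-inverseˡ (a , b) = cong₂ _,_ (inverse a) (inverse b)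
    where
    inverse : ∀ a → ℚ.- a + a ≡ 0ℚ
    inverse = solve-∀ ℚ-ring

  *K-comm : ∀ x y → x *K y ≡ y *K x
  *K-comm (a , b) (c , d) = cong₂ _,_ (comm₁ a b c d) (comm₂ a b c d)
    where
    comm₁ : ∀ a b c d → a * c - b * d ≡ c * a - d * b
    comm₁ = solve-∀ ℚ-ring
    comm₂ : ∀ a b c d → (a * d + b * c) - b * d ≡ (c * b + d * a) - d * b
    comm₂ = solve-∀ ℚ-ring

  *K-assoc : ∀ x y z → (x *K y) *K z ≡ x *K (y *K z)
  *K-assoc (a , b) (c , d) (e , f) = cong₂ _,_ (assoc₁ a b c d e f) (assoc₂ a b c d e f)
    where
    assoc₁ : ∀ a b c d e f → (a * c - b * d) * e - ((a * d + b * c) - b * d) * f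
                           ≡ a * (c * e - d * f) - b * ((c * f + d * e) - d * f)
    assoc₁ = solve-∀ ℚ-ring
    assoc₂ : ∀ a b c d e f → ((a * c - b * d) * f + ((a * d + b * c) - b * d) * e) - ((a * d + b * c) - b * d) * f
                           ≡ (a * ((c * f + d * e) - d * f) + b * (c * e - d * f)) - b * ((c * f + d * e) - d * f)
    assoc₂ = solve-∀ ℚ-ring

  *K-identityˡ : ∀ x → 1K *K x ≡ x
  *K-identityˡ (a , b) = cong₂ _,_ (identity₁ a b) (identity₂ a b)
    where
    identity₁ : ∀ a b → 1ℚ * a - 0ℚ * b ≡ a
    identity₁ = solve-∀ ℚ-ring
    identity₂ : ∀ a b → (1ℚ * b + 0ℚ * a) - 0ℚ * b ≡ b
    identity₂ = solve-∀ ℚ-ring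

  *K-distribˡ : ∀ x y z → x *K (y +K z) ≡ x *K y +K x *K z
  *K-distribˡ (a , b) (c , d) (e , f) = cong₂ _,_ (distrib₁ a b c d e f) (distrib₂ a b c d e f)
    where
    distrib₁ : ∀ a b c d e f → a * (c + e) - b * (d + f) ≡ (a * c - b * d) + (a * e - b * f)
    distrib₁ = solve-∀ ℚ-ring
    distrib₂ : ∀ a b c d e f → (a * (d + f) + b * (c + e)) - b * (d + f)
                             ≡ ((a * d + b * c) - b * d) + ((a * f + b * e) - b * f)
    distrib₂ = solve-∀ ℚ-ring

K-isCommutativeRing : IsCommutativeRing _+K_ _*K_ -K_ 0K 1K
K-isCommutativeRing = record
  { isRing = record
    { +-isAbelianGroup = record
      { isGroup = record
        { isMonoid = record
          { isSemigroup = record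
            { isMagma = record { isEquivalence = ≡.isEquivalence ; ∙-cong = cong₂ _+K_ }
            ; assoc   = +K-assoc }
          ; identity = +K-identityˡ , λ x → trans (+K-comm x 0K) (+K-identityˡ x) }
        ; inverse = +K-inverseˡ , λ x → trans (+K-comm x (-K x)) (+K-inverseˡ x)
        ; ⁻¹-cong = cong -K_ }
      ; comm = +K-comm }
    ; *-cong     = cong₂ _*K_
    ; *-assoc    = *K-assoc
    ; *-identity = *K-identityˡ , λ x → trans (*K-comm x 1K) (*K-identityˡ x)
    ; distrib    = *K-distribˡ , λ x y z → trans (*K-comm (y +K z) x)
                                              (trans (*K-distribˡ x y z) (cong₂ _+K_ (*K-comm x y) (*K-comm x z))) }
  ; *-comm = *K-comm }

K-commutativeRing : CommutativeRing 0ℓ 0ℓ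
K-commutativeRing = record { isCommutativeRing = K-isCommutativeRing }

open CommutativeRing K-commutativeRing using (zeroˡ)

_≟K_ : DecidableEquality K
_≟K_ = ≡-dec ℚP._≟_ ℚP._≟_

K-ring : AlmostCommutativeRing 0ℓ 0ℓ
K-ring = fromCommutativeRing K-commutativeRing isZero
  where
  isZero : (x : K) → Maybe (0K ≡ x)
  isZero x with x ≟K 0K
  ... | yes x≡0 = just (sym x≡0)
  ... | no  _   = nothing

normForm : ℚ → ℚ → ℚ
normForm a b = a ℚ.* a ℚ.- a ℚ.* b ℚ.+ b ℚ.* b

exponentAt : K → Mono
exponentAt (a , b) = (normForm a b , ℤ→ℚ (+ 2) ℚ.* a ℚ.- b , b)

exponentAt-correct : ∀ α → (normSq α , T α , T (α *K λK⁻¹)) ≡ exponentAt α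
exponentAt-correct (a , b) = cong₂ _,_ (normSq-coords a b) (cong₂ _,_ (T-coords a b) (T-λ⁻¹-coords a b))
  where
  open import Data.Rational using (_+_; _*_; _-_)
  normSq-coords : ∀ a b → a * (a - b) - b * (ℚ.- b) ≡ a * a - a * b + b * b
  normSq-coords = solve-∀ ℚ-ring
  T-coords : ∀ a b → a + (a - b) ≡ ℤ→ℚ (+ 2) * a - b
  T-coords = solve-∀ ℚ-ring
  T-λ⁻¹-coords : ∀ a b →
    let c = proj₁ λK⁻¹
        d = proj₂ λK⁻¹
        x = a * c - b * d
        y = (a * d + b * c) - b * d
    in x + (x - y) ≡ b
  T-λ⁻¹-coords = solve-∀ ℚ-ring

-- The monomial q^((|U|² + 2|V|²)/3) z^(T U) w^(T (U/λ)) of U = u₁ + u₂ω and V = v₁ + v₂ω.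
monomialOf : K → K → Mono
monomialOf (u₁ , u₂) (v₁ , v₂) =
  ((normForm u₁ u₂ ℚ.+ ℤ→ℚ (+ 2) ℚ.* normForm v₁ v₂) ℚ.* (+ 1 ℚ./ 3) , ℤ→ℚ (+ 2) ℚ.* u₁ ℚ.- u₂ , u₂)

module _ where
  open import Data.Rational using (_+_; _*_; _-_)

  exponent-lhs : ∀ x₁ x₂ y₁ y₂ →
    exponentAt (x₁ , x₂) +M σ-sq (exponentAt (y₁ , y₂))
      ≡ monomialOf (x₁ + ℤ→ℚ (+ 2) * y₁ , x₂ + ℤ→ℚ (+ 2) * y₂) (x₁ - y₁ , x₂ - y₂)
  exponent-lhs x₁ x₂ y₁ y₂ =
    cong₂ _,_ (polarisation x₁ x₂ y₁ y₂) (cong₂ _,_ (trace x₁ x₂ y₁ y₂) refl)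
    where
    polarisation : ∀ x₁ x₂ y₁ y₂ →
      let two = ℤ→ℚ (+ 2)
          N : ℚ → ℚ → ℚ
          N a b = a * a - a * b + b * b
      in N x₁ x₂ + two * N y₁ y₂
           ≡ (N (x₁ + two * y₁) (x₂ + two * y₂) + two * N (x₁ - y₁) (x₂ - y₂)) * (+ 1 ℚ./ 3)
    polarisation = solve-∀ ℚ-ring
    trace : ∀ x₁ x₂ y₁ y₂ →
      let two = ℤ→ℚ (+ 2)
      in (two * x₁ - x₂) + two * (two * y₁ - y₂) ≡ two * (x₁ + two * y₁) - (x₂ + two * y₂)
    trace = solve-∀ ℚ-ring

  exponent-rhs : ∀ x₁ x₂ y₁ y₂ →
    σ-wz (exponentAt (x₁ , x₂)) +M σ-sq11 (exponentAt (y₁ , y₂))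
      ≡ monomialOf (x₁ - ℤ→ℚ (+ 2) * x₂ , ℤ→ℚ (+ 2) * x₁ - x₂) (y₁ - ℤ→ℚ (+ 2) * y₂ , ℤ→ℚ (+ 2) * y₁ - y₂)
  exponent-rhs x₁ x₂ y₁ y₂ =
    cong₂ _,_ (norm-λ x₁ x₂ y₁ y₂) (cong₂ _,_ (trace x₁ x₂) (trace-λ⁻¹ x₁ x₂))
    where
    norm-λ : ∀ x₁ x₂ y₁ y₂ →
      let two = ℤ→ℚ (+ 2)
          N : ℚ → ℚ → ℚ
          N a b = a * a - a * b + b * b
      in N x₁ x₂ + two * N y₁ y₂
           ≡ (N (x₁ - two * x₂) (two * x₁ - x₂) + two * N (y₁ - two * y₂) (two * y₁ - y₂)) * (+ 1 ℚ./ 3)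
    norm-λ = solve-∀ ℚ-ring
    trace : ∀ x₁ x₂ →
      let two = ℤ→ℚ (+ 2)
      in ℚ.- (ℤ→ℚ (+ 3) * x₂) + 0ℚ ≡ two * (x₁ - two * x₂) - (two * x₁ - x₂)
    trace = solve-∀ ℚ-ring
    trace-λ⁻¹ : ∀ x₁ x₂ → (ℤ→ℚ (+ 2) * x₁ - x₂) + 0ℚ ≡ ℤ→ℚ (+ 2) * x₁ - x₂
    trace-λ⁻¹ = solve-∀ ℚ-ring

-- From here on, unqualified arithmetic is that of ℤ.
open import Data.Integer using (_+_; _*_; _-_)

ℤ→ℚ-mkℚ : ∀ n → ℤ→ℚ n ≡ mkℚ n 0 (Coprimality.sym (Coprimality.1-coprimeTo ∣ n ∣))
ℤ→ℚ-mkℚ n = ℚP.↥p/↧p≡p (mkℚ n 0 _)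

↥-ℤ→ℚ : ∀ n → ↥ ℤ→ℚ n ≡ n
↥-ℤ→ℚ n = cong ↥_ (ℤ→ℚ-mkℚ n)

ℤ→ℚ-+ : ∀ a b → ℤ→ℚ (a + b) ≡ ℤ→ℚ a ℚ.+ ℤ→ℚ b
ℤ→ℚ-+ a b rewrite ℤ→ℚ-mkℚ a | ℤ→ℚ-mkℚ b =
  cong (ℚ._/ 1) (cong₂ _+_ (sym (ℤP.*-identityʳ a)) (sym (ℤP.*-identityʳ b)))

ℤ→ℚ-* : ∀ a b → ℤ→ℚ (a * b) ≡ ℤ→ℚ a ℚ.* ℤ→ℚ b
ℤ→ℚ-* a b rewrite ℤ→ℚ-mkℚ a | ℤ→ℚ-mkℚ b = refl

ℤ→ℚ-neg : ∀ a → ℤ→ℚ (- a) ≡ ℚ.- ℤ→ℚ a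
ℤ→ℚ-neg a = begin
  ℤ→ℚ (- a)                           ≡⟨ cong ℤ→ℚ (ℤP.-1*i≡-i a) ⟨
  ℤ→ℚ (- + 1 * a)                     ≡⟨ ℤ→ℚ-* (- + 1) a ⟩
  ℤ→ℚ (- + 1) ℚ.* ℤ→ℚ a               ≡⟨ minus-one (ℤ→ℚ a) ⟩
  ℚ.- ℤ→ℚ a                           ∎
  where
  open ≡-Reasoning
  minus-one : ∀ x → ℤ→ℚ (- + 1) ℚ.* x ≡ ℚ.- x
  minus-one = solve-∀ ℚ-ring

ℤ→ℚ-- : ∀ a b → ℤ→ℚ (a - b) ≡ ℤ→ℚ a ℚ.- ℤ→ℚ b
ℤ→ℚ-- a b = trans (ℤ→ℚ-+ a (- b)) (cong (ℤ→ℚ a ℚ.+_) (ℤ→ℚ-neg b))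

res : ℤ → ℕ
res n = n %ℕ 3

quo : ℤ → ℤ
quo n = n /ℕ 3

res<3 : ∀ n → res n < 3
res<3 n = n%ℕd<d n 3

res+quo*3 : ∀ n → n ≡ + res n + quo n * + 3
res+quo*3 n = a≡a%ℕn+[a/ℕn]*n n 3

divmod3-unique : ∀ {r r′ q q′} → r < 3 → r′ < 3 →
                 + r + q * + 3 ≡ + r′ + q′ * + 3 → r ≡ r′ × q ≡ q′
divmod3-unique {r} {r′} {q} {q′} r<3 r′<3 eq = r≡r′ , q≡q′
  where
  diff : (q - q′) * + 3 ≡ + r′ - + r
  diff = begin
    (q - q′) * + 3                           ≡⟨ expand (+ r) q q′ ⟩
    (+ r + q * + 3) - (+ r + q′ * + 3)        ≡⟨ cong (_- (+ r + q′ * + 3)) eq ⟩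
    (+ r′ + q′ * + 3) - (+ r + q′ * + 3)      ≡⟨ cancel (+ r) (+ r′) q′ ⟩
    + r′ - + r                               ∎
    where
    open ≡-Reasoning
    expand : ∀ a q q′ → (q - q′) * + 3 ≡ (a + q * + 3) - (a + q′ * + 3)
    expand = solve-∀ ℤ-ring
    cancel : ∀ a b q′ → (b + q′ * + 3) - (a + q′ * + 3) ≡ b - a
    cancel = solve-∀ ℤ-ring
  small : ∣ q - q′ ∣ ℕ.* 3 < 3
  small = begin-strict
    ∣ q - q′ ∣ ℕ.* 3      ≡⟨ ℤP.∣i*j∣≡∣i∣*∣j∣ (q - q′) (+ 3) ⟨
    ∣ (q - q′) * + 3 ∣    ≡⟨ cong ∣_∣ (trans diff (ℤP.m-n≡m⊖n r′ r)) ⟩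
    ∣ r′ ⊖ r ∣            ≤⟨ ℤP.∣m⊝n∣≤m⊔n r′ r ⟩
    r′ ℕ.⊔ r              <⟨ ℕP.⊔-lub r′<3 r<3 ⟩
    3                     ∎
    where open ℕP.≤-Reasoning
  q≡q′ : q ≡ q′
  q≡q′ with ∣ q - q′ ∣ in eq₀ | small
  ... | zero  | _ = ℤP.i-j≡0⇒i≡j q q′ (ℤP.∣i∣≡0⇒i≡0 eq₀)
  ... | suc n | s≤s 3+n*3<3 = ⊥-elim (ℕP.m+n≮m 2 (n ℕ.* 3) 3+n*3<3)
  r≡r′ : r ≡ r′
  r≡r′ = ℤP.+-injective (+-cancelʳ (q′ * + 3) (+ r) (+ r′) (subst (λ t → + r + t * + 3 ≡ _) q≡q′ eq))

module _ (r : ℕ) (q : ℤ) (r<3 : r < 3) where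

  private
    n = + r + q * + 3
    unique = divmod3-unique {q = quo n} {q′ = q} (res<3 n) r<3 (sym (res+quo*3 n))

  res-+*3 : res (+ r + q * + 3) ≡ r
  res-+*3 = proj₁ unique

  quo-+*3 : quo (+ r + q * + 3) ≡ q
  quo-+*3 = proj₂ unique

res-*3 : ∀ t → res (t * + 3) ≡ 0
res-*3 t = trans (cong res (sym (ℤP.+-identityˡ (t * + 3)))) (res-+*3 0 t (s≤s z≤n))

quo-*3 : ∀ t → quo (t * + 3) ≡ t
quo-*3 t = trans (cong quo (sym (ℤP.+-identityˡ (t * + 3)))) (quo-+*3 0 t (s≤s z≤n))

infix 4 _≡₃_

record _≡₃_ (a b : ℤ) : Set where
  constructor differ-by
  field
    multiplier : ℤ
    difference : a ≡ b + multiplier * + 3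

≡₃-refl : ∀ {a} → a ≡₃ a
≡₃-refl {a} = differ-by (+ 0) (sym (ℤP.+-identityʳ a))

≡₃-res : ∀ n → n ≡₃ + res n
≡₃-res n = differ-by (quo n) (res+quo*3 n)

res-cong : ∀ {a b} → a ≡₃ b → res a ≡ res b
res-cong {a} {b} (differ-by t refl) = begin
  res (b + t * + 3)                            ≡⟨ cong (λ x → res (x + t * + 3)) (res+quo*3 b) ⟩
  res ((+ res b + quo b * + 3) + t * + 3)      ≡⟨ cong res (regroup (+ res b) (quo b) t) ⟩
  res (+ res b + (quo b + t) * + 3)            ≡⟨ res-+*3 (res b) (quo b + t) (res<3 b) ⟩
  res b                                        ∎
  where
  open ≡-Reasoning
  regroup : ∀ r q t → (r + q * + 3) + t * + 3 ≡ r + (q + t) * + 3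
  regroup = solve-∀ ℤ-ring

+-cong₃ : ∀ {a b c d} → a ≡₃ b → c ≡₃ d → a + c ≡₃ b + d
+-cong₃ {b = b} {d = d} (differ-by t refl) (differ-by s refl) = differ-by (t + s) (regroup b d t s)
  where
  regroup : ∀ b d t s → (b + t * + 3) + (d + s * + 3) ≡ (b + d) + (t + s) * + 3
  regroup = solve-∀ ℤ-ring

-‿cong₃ : ∀ {a b} → a ≡₃ b → - a ≡₃ - b
-‿cong₃ {b = b} (differ-by t refl) = differ-by (- t) (regroup b t)
  where
  regroup : ∀ b t → - (b + t * + 3) ≡ - b + (- t) * + 3
  regroup = solve-∀ ℤ-ring

-‿-cong₃ : ∀ {a b c d} → a ≡₃ b → c ≡₃ d → a - c ≡₃ b - d
-‿-cong₃ a≡b c≡d = +-cong₃ a≡b (-‿cong₃ c≡d)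

*-congˡ₃ : ∀ c {a b} → a ≡₃ b → c * a ≡₃ c * b
*-congˡ₃ c {b = b} (differ-by t refl) = differ-by (c * t) (regroup c b t)
  where
  regroup : ∀ c b t → c * (b + t * + 3) ≡ c * b + (c * t) * + 3
  regroup = solve-∀ ℤ-ring

divisibleBy3 : ℤ → Bool
divisibleBy3 n = res n ℕ.≡ᵇ 0

divisibleBy3-cong : ∀ {a b} → a ≡₃ b → divisibleBy3 a ≡ divisibleBy3 b
divisibleBy3-cong a≡b = cong (ℕ._≡ᵇ 0) (res-cong a≡b)

divisibleBy3-*3 : ∀ t → divisibleBy3 (t * + 3) ≡ true
divisibleBy3-*3 t = cong (ℕ._≡ᵇ 0) (res-*3 t)

divisibleBy3⇒≡quo*3 : ∀ n → divisibleBy3 n ≡ true → n ≡ quo n * + 3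
divisibleBy3⇒≡quo*3 n div with res n in eq
... | zero = trans (res+quo*3 n) (trans (cong (λ r → + r + quo n * + 3) eq) (ℤP.+-identityˡ _))

-- Changes of variables

Point : Set
Point = O × O

monomial : Point → Mono
monomial (U , V) = monomialOf (ι U) (ι V)

ℤ→ℚ-+2*- : ∀ a b c → ℤ→ℚ (a + + 2 * b - c) ≡ ℤ→ℚ a ℚ.+ ℤ→ℚ (+ 2) ℚ.* ℤ→ℚ b ℚ.- ℤ→ℚ c
ℤ→ℚ-+2*- a b c = begin
  ℤ→ℚ (a + + 2 * b - c)                                   ≡⟨ ℤ→ℚ-- (a + + 2 * b) c ⟩
  ℤ→ℚ (a + + 2 * b) ℚ.- ℤ→ℚ c                             ≡⟨ cong (ℚ._- ℤ→ℚ c) (ℤ→ℚ-+ a (+ 2 * b)) ⟩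
  ℤ→ℚ a ℚ.+ ℤ→ℚ (+ 2 * b) ℚ.- ℤ→ℚ c                       ≡⟨ cong (λ x → ℤ→ℚ a ℚ.+ x ℚ.- ℤ→ℚ c) (ℤ→ℚ-* (+ 2) b) ⟩
  ℤ→ℚ a ℚ.+ ℤ→ℚ (+ 2) ℚ.* ℤ→ℚ b ℚ.- ℤ→ℚ c                 ∎
  where open ≡-Reasoning

-- (U , V) = (α + 2α′ , α − α′) for α = β + k/λ and α′ = γ + k/λ, using 3/λ = −λ.
lhsPoint : ℤ → O × O → Point
lhsPoint k ((b₁ , b₂) , (g₁ , g₂)) = ((b₁ + + 2 * g₁ - k , b₂ + + 2 * g₂ - + 2 * k) , (b₁ - g₁ , b₂ - g₂))

monomial-lhsPoint : ∀ k β γ → expo (cS k) β +M expo (substExp σ-sq (cS k)) γ ≡ monomial (lhsPoint k (β , γ))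
monomial-lhsPoint k (b₁ , b₂) (g₁ , g₂) = begin
  expo (cS k) (b₁ , b₂) +M σ-sq (expo (cS k) (g₁ , g₂))
    ≡⟨ cong₂ (λ e e′ → e +M σ-sq e′) (exponentAt-correct (ι (b₁ , b₂) +K s)) (exponentAt-correct (ι (g₁ , g₂) +K s)) ⟩
  exponentAt (ι (b₁ , b₂) +K s) +M σ-sq (exponentAt (ι (g₁ , g₂) +K s))
    ≡⟨ exponent-lhs (ℤ→ℚ b₁ ℚ.+ s₁) (ℤ→ℚ b₂ ℚ.+ s₂) (ℤ→ℚ g₁ ℚ.+ s₁) (ℤ→ℚ g₂ ℚ.+ s₂) ⟩
  monomialOf ((ℤ→ℚ b₁ ℚ.+ s₁) ℚ.+ two ℚ.* (ℤ→ℚ g₁ ℚ.+ s₁) , (ℤ→ℚ b₂ ℚ.+ s₂) ℚ.+ two ℚ.* (ℤ→ℚ g₂ ℚ.+ s₂))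
             ((ℤ→ℚ b₁ ℚ.+ s₁) ℚ.- (ℤ→ℚ g₁ ℚ.+ s₁) , (ℤ→ℚ b₂ ℚ.+ s₂) ℚ.- (ℤ→ℚ g₂ ℚ.+ s₂))
    ≡⟨ cong₂ monomialOf (cong₂ _,_ U₁ U₂) (cong₂ _,_ (V b₁ g₁ _) (V b₂ g₂ _)) ⟩
  monomial (lhsPoint k ((b₁ , b₂) , (g₁ , g₂)))   ∎
  where
  open ≡-Reasoning
  s = fromℚ (ℤ→ℚ k) *K λK⁻¹
  s₁ = proj₁ s
  s₂ = proj₂ s
  two = ℤ→ℚ (+ 2)
  U₁ : (ℤ→ℚ b₁ ℚ.+ s₁) ℚ.+ two ℚ.* (ℤ→ℚ g₁ ℚ.+ s₁) ≡ ℤ→ℚ (b₁ + + 2 * g₁ - k)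
  U₁ = trans (u₁ (ℤ→ℚ b₁) (ℤ→ℚ g₁) (ℤ→ℚ k)) (sym (ℤ→ℚ-+2*- b₁ g₁ k))
    where
    u₁ : ∀ b g k → let s₁ = k ℚ.* proj₁ λK⁻¹ ℚ.- 0ℚ ℚ.* proj₂ λK⁻¹
                   in (b ℚ.+ s₁) ℚ.+ ℤ→ℚ (+ 2) ℚ.* (g ℚ.+ s₁) ≡ b ℚ.+ ℤ→ℚ (+ 2) ℚ.* g ℚ.- k
    u₁ = solve-∀ ℚ-ring
  U₂ : (ℤ→ℚ b₂ ℚ.+ s₂) ℚ.+ two ℚ.* (ℤ→ℚ g₂ ℚ.+ s₂) ≡ ℤ→ℚ (b₂ + + 2 * g₂ - + 2 * k)
  U₂ = trans (u₂ (ℤ→ℚ b₂) (ℤ→ℚ g₂) (ℤ→ℚ k))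
             (sym (trans (ℤ→ℚ-+2*- b₂ g₂ (+ 2 * k)) (cong (λ x → ℤ→ℚ b₂ ℚ.+ two ℚ.* ℤ→ℚ g₂ ℚ.- x) (ℤ→ℚ-* (+ 2) k))))
    where
    u₂ : ∀ b g k → let s₂ = (k ℚ.* proj₂ λK⁻¹ ℚ.+ 0ℚ ℚ.* proj₁ λK⁻¹) ℚ.- 0ℚ ℚ.* proj₂ λK⁻¹
                   in (b ℚ.+ s₂) ℚ.+ ℤ→ℚ (+ 2) ℚ.* (g ℚ.+ s₂) ≡ b ℚ.+ ℤ→ℚ (+ 2) ℚ.* g ℚ.- ℤ→ℚ (+ 2) ℚ.* k
    u₂ = solve-∀ ℚ-ring
  V : ∀ b g (s : ℚ) → (ℤ→ℚ b ℚ.+ s) ℚ.- (ℤ→ℚ g ℚ.+ s) ≡ ℤ→ℚ (b - g)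
  V b g s = trans (cancel (ℤ→ℚ b) (ℤ→ℚ g) s) (sym (ℤ→ℚ-- b g))
    where
    cancel : ∀ b g s → (b ℚ.+ s) ℚ.- (g ℚ.+ s) ≡ b ℚ.- g
    cancel = solve-∀ ℚ-ring

λ* : O → O
λ* (x , y) = (x - + 2 * y , + 2 * x - y)

_+ℤ_ : O → ℤ → O
(x , y) +ℤ j = (x + j , y)

-- (U , V) = (λα , λα′) for α = β + j/λ and α′ = γ + j′/λ.
rhsPoint : ℤ → ℤ → O × O → Point
rhsPoint j j′ (β , γ) = (λ* β +ℤ j , λ* γ +ℤ j′)

module _ (j : ℤ) (x y : ℤ) where

  private
    s = fromℚ (ℤ→ℚ j) *K λK⁻¹
    two = ℤ→ℚ (+ 2)
    α₁ = ℤ→ℚ x ℚ.+ proj₁ s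
    α₂ = ℤ→ℚ y ℚ.+ proj₂ s

  ι-λ*-+ℤ : (α₁ ℚ.- two ℚ.* α₂ , two ℚ.* α₁ ℚ.- α₂) ≡ ι (λ* (x , y) +ℤ j)
  ι-λ*-+ℤ = cong₂ _,_ (trans (first (ℤ→ℚ x) (ℤ→ℚ y) (ℤ→ℚ j)) (sym hom₁))
                      (trans (second (ℤ→ℚ x) (ℤ→ℚ y) (ℤ→ℚ j)) (sym hom₂))
    where
    first : ∀ x y j → let s₁ = j ℚ.* proj₁ λK⁻¹ ℚ.- 0ℚ ℚ.* proj₂ λK⁻¹
                          s₂ = (j ℚ.* proj₂ λK⁻¹ ℚ.+ 0ℚ ℚ.* proj₁ λK⁻¹) ℚ.- 0ℚ ℚ.* proj₂ λK⁻¹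
                      in (x ℚ.+ s₁) ℚ.- ℤ→ℚ (+ 2) ℚ.* (y ℚ.+ s₂) ≡ (x ℚ.- ℤ→ℚ (+ 2) ℚ.* y) ℚ.+ j
    first = solve-∀ ℚ-ring
    second : ∀ x y j → let s₁ = j ℚ.* proj₁ λK⁻¹ ℚ.- 0ℚ ℚ.* proj₂ λK⁻¹
                           s₂ = (j ℚ.* proj₂ λK⁻¹ ℚ.+ 0ℚ ℚ.* proj₁ λK⁻¹) ℚ.- 0ℚ ℚ.* proj₂ λK⁻¹
                       in ℤ→ℚ (+ 2) ℚ.* (x ℚ.+ s₁) ℚ.- (y ℚ.+ s₂) ≡ ℤ→ℚ (+ 2) ℚ.* x ℚ.- y
    second = solve-∀ ℚ-ring
    hom₁ : ℤ→ℚ (x - + 2 * y + j) ≡ (ℤ→ℚ x ℚ.- two ℚ.* ℤ→ℚ y) ℚ.+ ℤ→ℚ j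
    hom₁ = trans (ℤ→ℚ-+ (x - + 2 * y) j)
                 (cong (ℚ._+ ℤ→ℚ j) (trans (ℤ→ℚ-- x (+ 2 * y)) (cong (λ t → ℤ→ℚ x ℚ.- t) (ℤ→ℚ-* (+ 2) y))))
    hom₂ : ℤ→ℚ (+ 2 * x - y) ≡ two ℚ.* ℤ→ℚ x ℚ.- ℤ→ℚ y
    hom₂ = trans (ℤ→ℚ-- (+ 2 * x) y) (cong (ℚ._- ℤ→ℚ y) (ℤ→ℚ-* (+ 2) x))

monomial-rhsPoint : ∀ j j′ f f′ β γ →
  expo (substExp σ-wz (theta (fromℚ (ℤ→ℚ j) *K λK⁻¹) f)) β
    +M expo (substExp σ-sq11 (theta (fromℚ (ℤ→ℚ j′) *K λK⁻¹) f′)) γ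
  ≡ monomial (rhsPoint j j′ (β , γ))
monomial-rhsPoint j j′ f f′ (b₁ , b₂) (g₁ , g₂) = begin
  σ-wz (expo (theta s f) (b₁ , b₂)) +M σ-sq11 (expo (theta s′ f′) (g₁ , g₂))
    ≡⟨ cong₂ (λ e e′ → σ-wz e +M σ-sq11 e′) (exponentAt-correct (ι (b₁ , b₂) +K s))
                                            (exponentAt-correct (ι (g₁ , g₂) +K s′)) ⟩
  σ-wz (exponentAt (ι (b₁ , b₂) +K s)) +M σ-sq11 (exponentAt (ι (g₁ , g₂) +K s′))
    ≡⟨ exponent-rhs (ℤ→ℚ b₁ ℚ.+ proj₁ s) (ℤ→ℚ b₂ ℚ.+ proj₂ s) (ℤ→ℚ g₁ ℚ.+ proj₁ s′) (ℤ→ℚ g₂ ℚ.+ proj₂ s′) ⟩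
  _
    ≡⟨ cong₂ monomialOf (ι-λ*-+ℤ j b₁ b₂) (ι-λ*-+ℤ j′ g₁ g₂) ⟩
  monomial (rhsPoint j j′ ((b₁ , b₂) , (g₁ , g₂)))   ∎
  where
  open ≡-Reasoning
  s = fromℚ (ℤ→ℚ j) *K λK⁻¹
  s′ = fromℚ (ℤ→ℚ j′) *K λK⁻¹

∧-true : ∀ {x y} → x ∧ y ≡ true → x ≡ true × y ≡ true
∧-true {true} {true} _ = refl , refl

-- U ≡ j (mod λ) iff 3 ∣ u₁ + u₂ − j, as u₁ + u₂ω ≡ u₁ + u₂ (mod λ); then divλ j U = (U − j)/λ.
≡modλ : ℤ → O → Bool
≡modλ j (u₁ , u₂) = divisibleBy3 (u₁ + u₂ - j)

divλ : ℤ → O → O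
divλ j (u₁ , u₂) = (u₂ - quo (u₁ + u₂ - j) , u₂ - + 2 * quo (u₁ + u₂ - j))

module _ (j : ℤ) (b₁ b₂ : ℤ) where

  private
    sum≡ : (b₁ - + 2 * b₂ + j) + (+ 2 * b₁ - b₂) - j ≡ (b₁ - b₂) * + 3
    sum≡ = lemma b₁ b₂ j
      where
      lemma : ∀ b₁ b₂ j → (b₁ - + 2 * b₂ + j) + (+ 2 * b₁ - b₂) - j ≡ (b₁ - b₂) * + 3
      lemma = solve-∀ ℤ-ring

  ≡modλ-λ* : ≡modλ j (λ* (b₁ , b₂) +ℤ j) ≡ true
  ≡modλ-λ* = trans (cong divisibleBy3 sum≡) (divisibleBy3-*3 (b₁ - b₂))

  divλ-λ* : divλ j (λ* (b₁ , b₂) +ℤ j) ≡ (b₁ , b₂)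
  divλ-λ* rewrite sum≡ | quo-*3 (b₁ - b₂) = cong₂ _,_ (first b₁ b₂) (second b₁ b₂)
    where
    first : ∀ b₁ b₂ → (+ 2 * b₁ - b₂) - (b₁ - b₂) ≡ b₁
    first = solve-∀ ℤ-ring
    second : ∀ b₁ b₂ → (+ 2 * b₁ - b₂) - + 2 * (b₁ - b₂) ≡ b₂
    second = solve-∀ ℤ-ring

λ*-divλ : ∀ j U → ≡modλ j U ≡ true → λ* (divλ j U) +ℤ j ≡ U
λ*-divλ j (u₁ , u₂) div = cong₂ _,_ first (second u₂ t)
  where
  t = quo (u₁ + u₂ - j)
  3t≡ : u₁ + u₂ - j ≡ t * + 3
  3t≡ = divisibleBy3⇒≡quo*3 (u₁ + u₂ - j) div
  first : (u₂ - t) - + 2 * (u₂ - + 2 * t) + j ≡ u₁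
  first = trans (expand u₂ t j) (trans (cong (λ x → j - u₂ + x) (sym 3t≡)) (cancel u₁ u₂ j))
    where
    expand : ∀ u₂ t j → (u₂ - t) - + 2 * (u₂ - + 2 * t) + j ≡ j - u₂ + t * + 3
    expand = solve-∀ ℤ-ring
    cancel : ∀ u₁ u₂ j → j - u₂ + (u₁ + u₂ - j) ≡ u₁
    cancel = solve-∀ ℤ-ring
  second : ∀ u₂ t → + 2 * (u₂ - t) - (u₂ - + 2 * t) ≡ u₂
  second = solve-∀ ℤ-ring

rhsReindexing : ℤ → ℤ → Reindexing (O × O) Point
rhsReindexing j j′ = record
  { to       = rhsPoint j j′
  ; from     = λ (U , V) → (divλ j U , divλ j′ V)
  ; image    = λ (U , V) → ≡modλ j U ∧ ≡modλ j′ V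
  ; to-image = λ ((b₁ , b₂) , (g₁ , g₂)) → cong₂ _∧_ (≡modλ-λ* j b₁ b₂) (≡modλ-λ* j′ g₁ g₂)
  ; from-to  = λ ((b₁ , b₂) , (g₁ , g₂)) → cong₂ _,_ (divλ-λ* j b₁ b₂) (divλ-λ* j′ g₁ g₂)
  ; to-from  = λ (U , V) img → let (U≡j , V≡j′) = ∧-true img in
                 cong₂ _,_ (λ*-divλ j U U≡j) (λ*-divλ j′ V V≡j′)
  }

lhsImage : ℤ → Point → Bool
lhsImage k ((u₁ , u₂) , (v₁ , v₂)) = divisibleBy3 (u₁ - v₁ + k) ∧ divisibleBy3 (u₂ - v₂ + + 2 * k)

lhsPreimage : ℤ → Point → O × O
lhsPreimage k ((u₁ , u₂) , (v₁ , v₂)) = ((v₁ + g₁ , v₂ + g₂) , (g₁ , g₂))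
  where
  g₁ = quo (u₁ - v₁ + k)
  g₂ = quo (u₂ - v₂ + + 2 * k)

shear-diff : ∀ b g c → (b + + 2 * g - c) - (b - g) + c ≡ g * + 3
shear-diff = solve-∀ ℤ-ring

shear-inverse : ∀ u v c t → u - v + c ≡ t * + 3 → (v + t) + + 2 * t - c ≡ u
shear-inverse u v c t eq = trans (regroup v t c) (trans (cong (λ x → v + x - c) (sym eq)) (cancel u v c))
  where
  regroup : ∀ v t c → (v + t) + + 2 * t - c ≡ v + t * + 3 - c
  regroup = solve-∀ ℤ-ring
  cancel : ∀ u v c → v + (u - v + c) - c ≡ u
  cancel = solve-∀ ℤ-ring

-+-cancel : ∀ b g → (b - g) + g ≡ b
-+-cancel = solve-∀ ℤ-ring

+--cancel : ∀ v g → (v + g) - g ≡ v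
+--cancel = solve-∀ ℤ-ring

lhsReindexing : ℤ → Reindexing (O × O) Point
lhsReindexing k = record
  { to       = lhsPoint k
  ; from     = lhsPreimage k
  ; image    = lhsImage k
  ; to-image = λ ((b₁ , b₂) , (g₁ , g₂)) →
      cong₂ _∧_ (trans (cong divisibleBy3 (shear-diff b₁ g₁ k)) (divisibleBy3-*3 g₁))
                (trans (cong divisibleBy3 (shear-diff b₂ g₂ (+ 2 * k))) (divisibleBy3-*3 g₂))
  ; from-to  = from-to
  ; to-from  = to-from
  }
  where
  from-to : ∀ a → lhsPreimage k (lhsPoint k a) ≡ a
  from-to ((b₁ , b₂) , (g₁ , g₂))
    rewrite shear-diff b₁ g₁ k | shear-diff b₂ g₂ (+ 2 * k) | quo-*3 g₁ | quo-*3 g₂ =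
    cong₂ _,_ (cong₂ _,_ (-+-cancel b₁ g₁) (-+-cancel b₂ g₂)) refl
  to-from : ∀ b → lhsImage k b ≡ true → lhsPoint k (lhsPreimage k b) ≡ b
  to-from ((u₁ , u₂) , (v₁ , v₂)) img =
    cong₂ _,_ (cong₂ _,_ (shear-inverse u₁ v₁ k _ (divisibleBy3⇒≡quo*3 _ div₁))
                         (shear-inverse u₂ v₂ (+ 2 * k) _ (divisibleBy3⇒≡quo*3 _ div₂)))
              (cong₂ _,_ (+--cancel v₁ _) (+--cancel v₂ _))
    where
    div₁ = proj₁ (∧-true img)
    div₂ = proj₂ (∧-true img)

range-unique : ∀ R → Unique (range R)
range-unique R = Unique.map⁺ (λ {i} {j} eq → ℤP.+-injective (+-cancelʳ (- + R) (+ i) (+ j) eq)) (Unique.upTo⁺ _)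

box-unique : ∀ R → Unique (box R)
box-unique R = Unique.cartesianProduct⁺ (range-unique R) (range-unique R)

∈-range : ∀ {R} x → ∣ x ∣ ≤ R → x ∈ range R
∈-range {R} (+ n) n≤R =
  subst (_∈ range R) shift (∈.∈-map⁺ (λ i → + i - + R) (∈.∈-upTo⁺ (s≤s (ℕP.+-monoʳ-≤ R (ℕP.m≤n⇒m≤n+o 0 n≤R)))))
  where
  shift : + (R ℕ.+ n) - + R ≡ + n
  shift = trans (cong (_- + R) (ℤP.pos-+ R n)) (lemma (+ R) (+ n))
    where
    lemma : ∀ r n → r + n - r ≡ n
    lemma = solve-∀ ℤ-ring
∈-range {R} -[1+ n ] 1+n≤R =
  subst (_∈ range R) shift (∈.∈-map⁺ (λ i → + i - + R) (∈.∈-upTo⁺ (s≤s (ℕP.≤-trans (ℕP.m∸n≤m R (suc n)) (ℕP.m≤m+n R _)))))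
  where
  shift : + (R ℕ.∸ suc n) - + R ≡ -[1+ n ]
  shift = trans (cong (_- + R) (trans (sym (ℤP.⊖-≥ 1+n≤R)) (sym (ℤP.m-n≡m⊖n R (suc n))))) (lemma (+ R) (+ suc n))
    where
    lemma : ∀ r n → r - n - r ≡ - n
    lemma = solve-∀ ℤ-ring

∈-box : ∀ {R} x y → ∣ x ∣ ≤ R → ∣ y ∣ ≤ R → (x , y) ∈ box R
∈-box x y ∣x∣≤R ∣y∣≤R = ∈.∈-cartesianProduct⁺ (∈-range x ∣x∣≤R) (∈-range y ∣y∣≤R)

points : ℕ → List Point
points R = cartesianProduct (box R) (box R)

points-unique : ∀ R → Unique (points R)
points-unique R = Unique.cartesianProduct⁺ (box-unique R) (box-unique R)

Bounded : ℕ → Point → Set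
Bounded R ((u₁ , u₂) , (v₁ , v₂)) = ∣ u₁ ∣ ≤ R × ∣ u₂ ∣ ≤ R × ∣ v₁ ∣ ≤ R × ∣ v₂ ∣ ≤ R

∈-points : ∀ {R} b → Bounded R b → b ∈ points R
∈-points ((u₁ , u₂) , (v₁ , v₂)) (p , q , r , s) = ∈.∈-cartesianProduct⁺ (∈-box u₁ u₂ p q) (∈-box v₁ v₂ r s)

square-abs : ∀ a → a * a ≡ + (∣ a ∣ ℕ.* ∣ a ∣)
square-abs (+ n)    = sym (ℤP.pos-* n n)
square-abs -[1+ n ] = refl

n≤n*n : ∀ n → n ≤ n ℕ.* n
n≤n*n zero    = z≤n
n≤n*n (suc n) = ℕP.m≤m*n (suc n) (suc n)

squareSum : ℤ → ℤ → ℤ → ℤ → ℤ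
squareSum x y x′ y′ = (x * x + + 3 * (y * y)) + + 2 * (x′ * x′ + + 3 * (y′ * y′))

module _ (x y x′ y′ : ℤ) where

  private
    a = ∣ x ∣ ℕ.* ∣ x ∣
    b = ∣ y ∣ ℕ.* ∣ y ∣
    c = ∣ x′ ∣ ℕ.* ∣ x′ ∣
    d = ∣ y′ ∣ ℕ.* ∣ y′ ∣

    squareSum≡ : squareSum x y x′ y′ ≡ + ((a ℕ.+ 3 ℕ.* b) ℕ.+ 2 ℕ.* (c ℕ.+ 3 ℕ.* d))
    squareSum≡ = begin
      (x * x + + 3 * (y * y)) + + 2 * (x′ * x′ + + 3 * (y′ * y′))
        ≡⟨ cong₂ (λ s t → s + + 2 * t) (cong₂ (λ s t → s + + 3 * t) (square-abs x) (square-abs y))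
                                       (cong₂ (λ s t → s + + 3 * t) (square-abs x′) (square-abs y′)) ⟩
      (+ a + + 3 * + b) + + 2 * (+ c + + 3 * + d)
        ≡⟨ cong₂ (λ s t → (+ a + s) + + 2 * (+ c + t)) (ℤP.pos-* 3 b) (ℤP.pos-* 3 d) ⟨
      (+ a + + (3 ℕ.* b)) + + 2 * (+ c + + (3 ℕ.* d))
        ≡⟨ cong₂ (λ s t → s + + 2 * t) (ℤP.pos-+ a _) (ℤP.pos-+ c _) ⟨
      + (a ℕ.+ 3 ℕ.* b) + + 2 * + (c ℕ.+ 3 ℕ.* d)
        ≡⟨ cong (λ t → + (a ℕ.+ 3 ℕ.* b) + t) (ℤP.pos-* 2 (c ℕ.+ 3 ℕ.* d)) ⟨
      + (a ℕ.+ 3 ℕ.* b) + + (2 ℕ.* (c ℕ.+ 3 ℕ.* d))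
        ≡⟨ ℤP.pos-+ (a ℕ.+ 3 ℕ.* b) (2 ℕ.* (c ℕ.+ 3 ℕ.* d)) ⟨
      + ((a ℕ.+ 3 ℕ.* b) ℕ.+ 2 ℕ.* (c ℕ.+ 3 ℕ.* d)) ∎
      where open ≡-Reasoning

  ≤-squareSum : ∣ y ∣ ≤ ∣ squareSum x y x′ y′ ∣ × ∣ y′ ∣ ≤ ∣ squareSum x y x′ y′ ∣
  ≤-squareSum rewrite squareSum≡ = y≤ , y′≤
    where
    open ℕP.≤-Reasoning
    y≤ : ∣ y ∣ ≤ (a ℕ.+ 3 ℕ.* b) ℕ.+ 2 ℕ.* (c ℕ.+ 3 ℕ.* d)
    y≤ = begin
      ∣ y ∣                                      ≤⟨ n≤n*n ∣ y ∣ ⟩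
      b                                          ≤⟨ ℕP.m≤n*m b 3 ⟩
      3 ℕ.* b                                    ≤⟨ ℕP.m≤n+m _ a ⟩
      a ℕ.+ 3 ℕ.* b                              ≤⟨ ℕP.m≤m+n _ _ ⟩
      (a ℕ.+ 3 ℕ.* b) ℕ.+ 2 ℕ.* (c ℕ.+ 3 ℕ.* d)  ∎
    y′≤ : ∣ y′ ∣ ≤ (a ℕ.+ 3 ℕ.* b) ℕ.+ 2 ℕ.* (c ℕ.+ 3 ℕ.* d)
    y′≤ = begin
      ∣ y′ ∣                                     ≤⟨ n≤n*n ∣ y′ ∣ ⟩
      d                                          ≤⟨ ℕP.m≤n*m d 3 ⟩
      3 ℕ.* d                                    ≤⟨ ℕP.m≤n+m _ c ⟩
      c ℕ.+ 3 ℕ.* d                              ≤⟨ ℕP.m≤n*m _ 2 ⟩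
      2 ℕ.* (c ℕ.+ 3 ℕ.* d)                      ≤⟨ ℕP.m≤n+m _ (a ℕ.+ 3 ℕ.* b) ⟩
      (a ℕ.+ 3 ℕ.* b) ℕ.+ 2 ℕ.* (c ℕ.+ 3 ℕ.* d)  ∎

normFormℤ : ℤ → ℤ → ℤ
normFormℤ a b = a * a - a * b + b * b

normFormℤ-comm : ∀ a b → normFormℤ a b ≡ normFormℤ b a
normFormℤ-comm = comm
  where
  comm : ∀ a b → a * a - a * b + b * b ≡ b * b - b * a + a * a
  comm = solve-∀ ℤ-ring

four-normFormℤ : ∀ u₁ u₂ v₁ v₂ →
  (normFormℤ u₁ u₂ + + 2 * normFormℤ v₁ v₂) * + 4 ≡ squareSum (+ 2 * u₁ - u₂) u₂ (+ 2 * v₁ - v₂) v₂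
four-normFormℤ = identity
  where
  identity : ∀ u₁ u₂ v₁ v₂ →
    let N : ℤ → ℤ → ℤ
        N a b = a * a - a * b + b * b
        x = + 2 * u₁ - u₂
        x′ = + 2 * v₁ - v₂
    in (N u₁ u₂ + + 2 * N v₁ v₂) * + 4 ≡ (x * x + + 3 * (u₂ * u₂)) + + 2 * (x′ * x′ + + 3 * (v₂ * v₂))
  identity = solve-∀ ℤ-ring

ℤ→ℚ-normForm : ∀ a b → ℤ→ℚ (normFormℤ a b) ≡ normForm (ℤ→ℚ a) (ℤ→ℚ b)
ℤ→ℚ-normForm a b = begin
  ℤ→ℚ (a * a - a * b + b * b)                         ≡⟨ ℤ→ℚ-+ (a * a - a * b) (b * b) ⟩
  ℤ→ℚ (a * a - a * b) ℚ.+ ℤ→ℚ (b * b)                 ≡⟨ cong (ℚ._+ ℤ→ℚ (b * b)) (ℤ→ℚ-- (a * a) (a * b)) ⟩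
  ℤ→ℚ (a * a) ℚ.- ℤ→ℚ (a * b) ℚ.+ ℤ→ℚ (b * b)         ≡⟨ cong₂ (λ s t → s ℚ.- t ℚ.+ ℤ→ℚ (b * b)) (ℤ→ℚ-* a a) (ℤ→ℚ-* a b) ⟩
  ℤ→ℚ a ℚ.* ℤ→ℚ a ℚ.- ℤ→ℚ a ℚ.* ℤ→ℚ b ℚ.+ ℤ→ℚ (b * b) ≡⟨ cong (ℤ→ℚ a ℚ.* ℤ→ℚ a ℚ.- ℤ→ℚ a ℚ.* ℤ→ℚ b ℚ.+_) (ℤ→ℚ-* b b) ⟩
  normForm (ℤ→ℚ a) (ℤ→ℚ b)                            ∎
  where open ≡-Reasoning

normOf : Mono → ℤ
normOf m = ↥ (proj₁ m ℚ.* ℤ→ℚ (+ 3))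

monomial-norm : ∀ {m} u₁ u₂ v₁ v₂ → monomial ((u₁ , u₂) , (v₁ , v₂)) ≡ m →
                normFormℤ u₁ u₂ + + 2 * normFormℤ v₁ v₂ ≡ normOf m
monomial-norm {m} u₁ u₂ v₁ v₂ eq = begin
  n                              ≡⟨ ↥-ℤ→ℚ n ⟨
  ↥ ℤ→ℚ n                        ≡⟨ cong ↥_ (trans hom (thirds _)) ⟩
  ↥ (q ℚ.* (+ 1 ℚ./ 3) ℚ.* ℤ→ℚ (+ 3)) ≡⟨ cong (λ e → ↥ (proj₁ e ℚ.* ℤ→ℚ (+ 3))) eq ⟩
  normOf m                       ∎
  where
  open ≡-Reasoning
  n = normFormℤ u₁ u₂ + + 2 * normFormℤ v₁ v₂
  q = normForm (ℤ→ℚ u₁) (ℤ→ℚ u₂) ℚ.+ ℤ→ℚ (+ 2) ℚ.* normForm (ℤ→ℚ v₁) (ℤ→ℚ v₂)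
  hom : ℤ→ℚ n ≡ q
  hom = trans (ℤ→ℚ-+ (normFormℤ u₁ u₂) (+ 2 * normFormℤ v₁ v₂))
              (cong₂ ℚ._+_ (ℤ→ℚ-normForm u₁ u₂)
                           (trans (ℤ→ℚ-* (+ 2) (normFormℤ v₁ v₂)) (cong (ℤ→ℚ (+ 2) ℚ.*_) (ℤ→ℚ-normForm v₁ v₂))))
  thirds : ∀ x → x ≡ x ℚ.* (+ 1 ℚ./ 3) ℚ.* ℤ→ℚ (+ 3)
  thirds = solve-∀ ℚ-ring

-- A point with monomial m has |U|² + 2|V|² = N = 3m₁ (monomial-norm); four-normFormℤ and its
-- image under u₁ ↔ u₂, v₁ ↔ v₂ write 4N as sums of squares containing every coordinate squared.
supportBound : Mono → ℕ
supportBound m = ∣ normOf m ∣ ℕ.* 4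

bounded-support : ∀ {m} b → monomial b ≡ m → Bounded (supportBound m) b
bounded-support {m} ((u₁ , u₂) , (v₁ , v₂)) eq =
  via u₁ swapped (proj₁ swapped-bounds) , via u₂ direct (proj₁ direct-bounds) ,
  via v₁ swapped (proj₂ swapped-bounds) , via v₂ direct (proj₂ direct-bounds)
  where
  direct-bounds = ≤-squareSum (+ 2 * u₁ - u₂) u₂ (+ 2 * v₁ - v₂) v₂
  swapped-bounds = ≤-squareSum (+ 2 * u₂ - u₁) u₁ (+ 2 * v₂ - v₁) v₁
  N = normOf m
  norm≡N : normFormℤ u₁ u₂ + + 2 * normFormℤ v₁ v₂ ≡ N
  norm≡N = monomial-norm u₁ u₂ v₁ v₂ eq
  direct : squareSum (+ 2 * u₁ - u₂) u₂ (+ 2 * v₁ - v₂) v₂ ≡ N * + 4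
  direct = trans (sym (four-normFormℤ u₁ u₂ v₁ v₂)) (cong (_* + 4) norm≡N)
  swapped : squareSum (+ 2 * u₂ - u₁) u₁ (+ 2 * v₂ - v₁) v₁ ≡ N * + 4
  swapped = trans (sym (four-normFormℤ u₂ u₁ v₂ v₁))
                  (cong (_* + 4) (trans (cong₂ (λ s t → s + + 2 * t) (normFormℤ-comm u₂ u₁) (normFormℤ-comm v₂ v₁))
                                        norm≡N))
  via : ∀ x {Q} → Q ≡ N * + 4 → ∣ x ∣ ≤ ∣ Q ∣ → ∣ x ∣ ≤ supportBound m
  via x Q≡ ∣x∣≤∣Q∣ = subst (∣ x ∣ ≤_) (trans (cong ∣_∣ Q≡) (ℤP.∣i*j∣≡∣i∣*∣j∣ N (+ 4))) ∣x∣≤∣Q∣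

module Scaled (M : ℕ) where

  infix 4 _≲_

  record _≲_ (x : ℤ) (c : ℕ) : Set where
    constructor bounded
    field bound : ∣ x ∣ ≤ c ℕ.* M

  ≲-+ : ∀ {x y a b} → x ≲ a → y ≲ b → x + y ≲ a ℕ.+ b
  ≲-+ {x} {y} {a} {b} (bounded x≤) (bounded y≤) = bounded (ℕP.≤-trans (ℤP.∣i+j∣≤∣i∣+∣j∣ x y)
    (ℕP.≤-trans (ℕP.+-mono-≤ x≤ y≤) (ℕP.≤-reflexive (sym (ℕP.*-distribʳ-+ M a b)))))

  ≲-- : ∀ {x y a b} → x ≲ a → y ≲ b → x - y ≲ a ℕ.+ b
  ≲-- {x} {y} {a} {b} (bounded x≤) (bounded y≤) = bounded (ℕP.≤-trans (ℤP.∣i-j∣≤∣i∣+∣j∣ x y)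
    (ℕP.≤-trans (ℕP.+-mono-≤ x≤ y≤) (ℕP.≤-reflexive (sym (ℕP.*-distribʳ-+ M a b)))))

  ≲-2* : ∀ {x a} → x ≲ a → + 2 * x ≲ 2 ℕ.* a
  ≲-2* {x} {a} (bounded x≤) = bounded (ℕP.≤-trans (ℕP.≤-reflexive (ℤP.∣i*j∣≡∣i∣*∣j∣ (+ 2) x))
    (ℕP.≤-trans (ℕP.*-monoʳ-≤ 2 x≤) (ℕP.≤-reflexive (sym (ℕP.*-assoc 2 a M)))))

  ≲-quo : ∀ {x a} → divisibleBy3 x ≡ true → x ≲ a → quo x ≲ a
  ≲-quo {x} div (bounded x≤) = bounded (ℕP.≤-trans (ℕP.m≤m*n ∣ quo x ∣ 3)
    (ℕP.≤-trans (ℕP.≤-reflexive (sym (ℤP.∣i*j∣≡∣i∣*∣j∣ (quo x) (+ 3))))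
                (subst (λ t → ∣ t ∣ ≤ _) (divisibleBy3⇒≡quo*3 x div) x≤)))

  ≲-weaken : ∀ {x a b} → a ≤ b → x ≲ a → x ≲ b
  ≲-weaken a≤b (bounded x≤) = bounded (ℕP.≤-trans x≤ (ℕP.*-monoˡ-≤ M a≤b))

-- 7 = 1 + 2·3 comes from the coordinate u₂ − 2(u₁ + u₂ − j)/3 of divλ j U, the largest one.
preimageRadius : ℕ → ℕ → ℕ
preimageRadius B K = 7 ℕ.* (B ℕ.+ K ℕ.+ 1)

module _ {B K R : ℕ} (R₀≤R : preimageRadius B K ≤ R) where

  private
    M = B ℕ.+ K ℕ.+ 1
    open Scaled M

    B≤M : B ≤ M
    B≤M = ℕP.≤-trans (ℕP.m≤m+n B K) (ℕP.m≤m+n (B ℕ.+ K) 1)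

    K≤M : K ≤ M
    K≤M = ℕP.≤-trans (ℕP.m≤n+m K B) (ℕP.m≤m+n (B ℕ.+ K) 1)

    1≤M : 1 ≤ M
    1≤M = ℕP.m≤n+m 1 (B ℕ.+ K)

    ≲1 : ∀ x {n} → ∣ x ∣ ≤ n → n ≤ M → x ≲ 1
    ≲1 x ∣x∣≤n n≤M = bounded (ℕP.≤-trans ∣x∣≤n (ℕP.≤-trans n≤M (ℕP.≤-reflexive (sym (ℕP.+-identityʳ M)))))

    within : ∀ {x a} → a ≤ 7 → x ≲ a → ∣ x ∣ ≤ R
    within a≤7 x≲a = ℕP.≤-trans (_≲_.bound (≲-weaken a≤7 x≲a)) R₀≤R

  lhsPreimage-bounded : ∀ {k} b → ∣ k ∣ ≤ K → Bounded B b → lhsImage k b ≡ true → Bounded R (lhsPreimage k b)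
  lhsPreimage-bounded {k} ((u₁ , u₂) , (v₁ , v₂)) ∣k∣≤K (∣u₁∣≤B , ∣u₂∣≤B , ∣v₁∣≤B , ∣v₂∣≤B) img =
    within (ℕP.m≤m+n 4 3) (≲-+ v₁≲ g₁≲) , within (ℕP.m≤m+n 5 2) (≲-+ v₂≲ g₂≲) ,
    within (ℕP.m≤m+n 3 4) g₁≲ , within (ℕP.m≤m+n 4 3) g₂≲
    where
    k≲ = ≲1 k ∣k∣≤K K≤M
    v₁≲ = ≲1 v₁ ∣v₁∣≤B B≤M
    v₂≲ = ≲1 v₂ ∣v₂∣≤B B≤M
    g₁≲ = ≲-quo (proj₁ (∧-true img)) (≲-+ (≲-- (≲1 u₁ ∣u₁∣≤B B≤M) v₁≲) k≲)
    g₂≲ = ≲-quo (proj₂ (∧-true img)) (≲-+ (≲-- (≲1 u₂ ∣u₂∣≤B B≤M) v₂≲) (≲-2* k≲))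

  divλ-bounded : ∀ {j} U → ∣ j ∣ ≤ 1 → ∣ proj₁ U ∣ ≤ B → ∣ proj₂ U ∣ ≤ B → ≡modλ j U ≡ true →
                 ∣ proj₁ (divλ j U) ∣ ≤ R × ∣ proj₂ (divλ j U) ∣ ≤ R
  divλ-bounded {j} (u₁ , u₂) ∣j∣≤1 ∣u₁∣≤B ∣u₂∣≤B div =
    within (ℕP.m≤m+n 4 3) (≲-- u₂≲ t≲) , within ℕP.≤-refl (≲-- u₂≲ (≲-2* t≲))
    where
    u₂≲ = ≲1 u₂ ∣u₂∣≤B B≤M
    t≲ = ≲-quo div (≲-- (≲-+ (≲1 u₁ ∣u₁∣≤B B≤M) u₂≲) (≲1 j ∣j∣≤1 1≤M))

-- Weights and the units of O

open ListSum (CommutativeRing.commutativeSemiring K-commutativeRing)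

[_] : Bool → K
[ true  ] = 1K
[ false ] = 0K

three : K
three = fromℚ (ℤ→ℚ (+ 3))

lhsWeight : ℤ → Point → K
lhsWeight k b = three *K [ lhsImage k b ]

-- For U ∈ λO, U/λ = ((2u₂ − u₁) + (u₂ − 2u₁)ω)/3, so χ(U/λ) = ω^(u₂ − u₁).
χ-pair : Point → K
χ-pair ((u₁ , u₂) , (v₁ , v₂)) = ωpow (u₂ - u₁) *K ωpow (v₂ - v₁)

χ̄-pair : Point → K
χ̄-pair ((u₁ , u₂) , (v₁ , v₂)) = ωpow (u₁ - u₂) *K ωpow (v₂ - v₁)

rhsWeight : ℤ → Point → K
rhsWeight k b =
  [ Reindexing.image (rhsReindexing (+ 0) (+ 0)) b ] *K (1K +K ωpow k *K χ-pair b +K ωpow (- k) *K χ̄-pair b)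
  +K [ Reindexing.image (rhsReindexing (+ 1) (+ 1)) b ]
  +K [ Reindexing.image (rhsReindexing (- + 1) (+ 1)) b ]

infix 4 _≋_

_≋_ : Point → Point → Set
((u₁ , u₂) , (v₁ , v₂)) ≋ ((u₁′ , u₂′) , (v₁′ , v₂′)) = u₁ ≡₃ u₁′ × u₂ ≡₃ u₂′ × v₁ ≡₃ v₁′ × v₂ ≡₃ v₂′

residuePoint : ℕ → ℕ → ℕ → ℕ → Point
residuePoint u₁ u₂ v₁ v₂ = ((+ u₁ , + u₂) , (+ v₁ , + v₂))

residues : Point → Point
residues ((u₁ , u₂) , (v₁ , v₂)) = residuePoint (res u₁) (res u₂) (res v₁) (res v₂)

≋-residues : ∀ b → b ≋ residues b
≋-residues ((u₁ , u₂) , (v₁ , v₂)) = ≡₃-res u₁ , ≡₃-res u₂ , ≡₃-res v₁ , ≡₃-res v₂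

ω^ : ℕ → K
ω^ 0 = 1K
ω^ 1 = ωK
ω^ _ = ωK *K ωK

ωpow≡ω^res : ∀ n → ωpow n ≡ ω^ (res n)
ωpow≡ω^res n with n %ℕ 3
... | 0           = refl
... | 1           = refl
... | suc (suc _) = refl

ωpow-cong : ∀ {a b} → a ≡₃ b → ωpow a ≡ ωpow b
ωpow-cong {a} {b} a≡b = trans (ωpow≡ω^res a) (trans (cong ω^ (res-cong a≡b)) (sym (ωpow≡ω^res b)))

lhsWeight-cong : ∀ {k k′ b b′} → k ≡₃ k′ → b ≋ b′ → lhsWeight k b ≡ lhsWeight k′ b′
lhsWeight-cong {b = (u₁ , u₂) , (v₁ , v₂)} {b′ = (u₁′ , u₂′) , (v₁′ , v₂′)} k≡ (u₁≡ , u₂≡ , v₁≡ , v₂≡) =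
  cong (λ x → three *K [ x ])
       (cong₂ _∧_ (divisibleBy3-cong (+-cong₃ (-‿-cong₃ u₁≡ v₁≡) k≡))
                  (divisibleBy3-cong (+-cong₃ (-‿-cong₃ u₂≡ v₂≡) (*-congˡ₃ (+ 2) k≡))))

≡modλ-cong : ∀ {j u₁ u₂ u₁′ u₂′} → u₁ ≡₃ u₁′ → u₂ ≡₃ u₂′ → ≡modλ j (u₁ , u₂) ≡ ≡modλ j (u₁′ , u₂′)
≡modλ-cong u₁≡ u₂≡ = divisibleBy3-cong (-‿-cong₃ (+-cong₃ u₁≡ u₂≡) ≡₃-refl)

rhsWeight-cong : ∀ {k k′ b b′} → k ≡₃ k′ → b ≋ b′ → rhsWeight k b ≡ rhsWeight k′ b′
rhsWeight-cong {b = (u₁ , u₂) , (v₁ , v₂)} {b′ = (u₁′ , u₂′) , (v₁′ , v₂′)} k≡ (u₁≡ , u₂≡ , v₁≡ , v₂≡) =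
  cong₂ _+K_ (cong₂ _+K_ (cong₂ (λ x y → [ x ] *K y) (image (+ 0) (+ 0)) weight)
                         (cong [_] (image (+ 1) (+ 1))))
             (cong [_] (image (- + 1) (+ 1)))
  where
  image : ∀ j j′ → ≡modλ j (u₁ , u₂) ∧ ≡modλ j′ (v₁ , v₂) ≡ ≡modλ j (u₁′ , u₂′) ∧ ≡modλ j′ (v₁′ , v₂′)
  image j j′ = cong₂ _∧_ (≡modλ-cong {j} u₁≡ u₂≡) (≡modλ-cong {j′} v₁≡ v₂≡)
  χv = ωpow-cong (-‿-cong₃ v₂≡ v₁≡)
  weight = cong₂ (λ x y → 1K +K x +K y)
                 (cong₂ _*K_ (ωpow-cong k≡) (cong₂ _*K_ (ωpow-cong (-‿-cong₃ u₂≡ u₁≡)) χv))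
                 (cong₂ _*K_ (ωpow-cong (-‿cong₃ k≡)) (cong₂ _*K_ (ωpow-cong (-‿-cong₃ u₁≡ u₂≡)) χv))

record Symmetry : Set where
  field
    act          : Point → Point
    inverse      : Point → Point
    inverse-act  : ∀ b → inverse (act b) ≡ b
    act-inverse  : ∀ b → act (inverse b) ≡ b
    monomial-act : ∀ b → monomial (act b) ≡ monomial b
    act-cong     : ∀ {b b′} → b ≋ b′ → act b ≋ act b′

open Symmetry

idₛ : Symmetry
idₛ = record
  { act = λ b → b ; inverse = λ b → b ; inverse-act = λ _ → refl ; act-inverse = λ _ → refl
  ; monomial-act = λ _ → refl ; act-cong = λ b≋b′ → b≋b′ }

_∘ₛ_ : Symmetry → Symmetry → Symmetry
σ ∘ₛ τ = record
  { act          = λ b → act σ (act τ b)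
  ; inverse      = λ b → inverse τ (inverse σ b)
  ; inverse-act  = λ b → trans (cong (inverse τ) (inverse-act σ (act τ b))) (inverse-act τ b)
  ; act-inverse  = λ b → trans (cong (act σ) (act-inverse τ (inverse σ b))) (act-inverse σ b)
  ; monomial-act = λ b → trans (monomial-act σ (act τ b)) (monomial-act τ b)
  ; act-cong     = λ b≋b′ → act-cong σ (act-cong τ b≋b′)
  }

monomial-cong-norm : ∀ U v₁ v₂ v₁′ v₂′ → normFormℤ v₁′ v₂′ ≡ normFormℤ v₁ v₂ →
                     monomial (U , (v₁′ , v₂′)) ≡ monomial (U , (v₁ , v₂))
monomial-cong-norm (x , y) v₁ v₂ v₁′ v₂′ eq =
  cong (λ n → ((normForm (ℤ→ℚ x) (ℤ→ℚ y) ℚ.+ ℤ→ℚ (+ 2) ℚ.* n) ℚ.* (+ 1 ℚ./ 3) , ℤ→ℚ (+ 2) ℚ.* ℤ→ℚ x ℚ.- ℤ→ℚ y , ℤ→ℚ y))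
       (trans (sym (ℤ→ℚ-normForm v₁′ v₂′)) (trans (cong ℤ→ℚ eq) (ℤ→ℚ-normForm v₁ v₂)))

rotation : Symmetry
rotation = record
  { act          = λ (U , (v₁ , v₂)) → (U , (- v₂ , v₁ - v₂))
  ; inverse      = λ (U , (v₁ , v₂)) → (U , (v₂ - v₁ , - v₁))
  ; inverse-act  = λ (U , (v₁ , v₂)) → cong (λ V → (U , V)) (cong₂ _,_ (cancel₁ v₁ v₂) (ℤP.neg-involutive v₂))
  ; act-inverse  = λ (U , (v₁ , v₂)) → cong (λ V → (U , V)) (cong₂ _,_ (ℤP.neg-involutive v₁) (cancel₂ v₁ v₂))
  ; monomial-act = λ (U , (v₁ , v₂)) → monomial-cong-norm U v₁ v₂ (- v₂) (v₁ - v₂) (norm v₁ v₂)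
  ; act-cong     = λ (u₁≡ , u₂≡ , v₁≡ , v₂≡) → u₁≡ , u₂≡ , -‿cong₃ v₂≡ , -‿-cong₃ v₁≡ v₂≡
  }
  where
  cancel₁ : ∀ v₁ v₂ → (v₁ - v₂) - - v₂ ≡ v₁
  cancel₁ = solve-∀ ℤ-ring
  cancel₂ : ∀ v₁ v₂ → (v₂ - v₁) - - v₁ ≡ v₂
  cancel₂ = solve-∀ ℤ-ring
  norm : ∀ v₁ v₂ → let N : ℤ → ℤ → ℤ
                       N a b = a * a - a * b + b * b
                   in N (- v₂) (v₁ - v₂) ≡ N v₁ v₂
  norm = solve-∀ ℤ-ring

negation : Symmetry
negation = record
  { act          = negate
  ; inverse      = negate
  ; inverse-act  = involutive
  ; act-inverse  = involutive
  ; monomial-act = λ (U , (v₁ , v₂)) → monomial-cong-norm U v₁ v₂ (- v₁) (- v₂) (norm v₁ v₂)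
  ; act-cong     = λ (u₁≡ , u₂≡ , v₁≡ , v₂≡) → u₁≡ , u₂≡ , -‿cong₃ v₁≡ , -‿cong₃ v₂≡
  }
  where
  negate : Point → Point
  negate (U , (v₁ , v₂)) = (U , (- v₁ , - v₂))
  involutive : ∀ b → negate (negate b) ≡ b
  involutive (U , (v₁ , v₂)) = cong (λ V → (U , V)) (cong₂ _,_ (ℤP.neg-involutive v₁) (ℤP.neg-involutive v₂))
  norm : ∀ v₁ v₂ → let N : ℤ → ℤ → ℤ
                       N a b = a * a - a * b + b * b
                   in N (- v₁) (- v₂) ≡ N v₁ v₂
  norm = solve-∀ ℤ-ring

units : List Symmetry
units = idₛ ∷ rotation ∷ rotation ∘ₛ rotation
      ∷ negation ∷ negation ∘ₛ rotation ∷ negation ∘ₛ (rotation ∘ₛ rotation) ∷ []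

average : (Point → K) → Point → K
average G b = ∑[ σ ∈ units ] G (act σ b)

average-cong : ∀ {G G′ : Point → K} → (∀ {b b′} → b ≋ b′ → G b ≡ G′ b′) →
               ∀ {b b′} → b ≋ b′ → average G b ≡ average G′ b′
average-cong G≡G′ b≋b′ = ∑-cong units (λ σ → G≡G′ (act-cong σ b≋b′))

AveragesAgree : ℤ → Point → Set
AveragesAgree k b = average (lhsWeight k) b ≡ average (rhsWeight k) b

averages-agree? : ∀ k b → Dec (AveragesAgree k b)
averages-agree? k b = average (lhsWeight k) b ≟K average (rhsWeight k) b

digits : List ℕ
digits = upTo 3

averages-agree-on-residues :
  All (λ e → All (λ u₁ → All (λ u₂ → All (λ v₁ → All (λ v₂ →
    AveragesAgree (+ e) (residuePoint u₁ u₂ v₁ v₂)) digits) digits) digits) digits) digits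
averages-agree-on-residues = toWitness {a? = all? (λ e → all? (λ u₁ → all? (λ u₂ → all? (λ v₁ → all? (λ v₂ →
  averages-agree? (+ e) (residuePoint u₁ u₂ v₁ v₂)) digits) digits) digits) digits) digits} _

averages-agree : ∀ k b → AveragesAgree k b
averages-agree k b@((u₁ , u₂) , (v₁ , v₂)) = begin
  average (lhsWeight k) b                     ≡⟨ average-cong (lhsWeight-cong (≡₃-res k)) (≋-residues b) ⟩
  average (lhsWeight (+ res k)) (residues b)  ≡⟨ on-residues ⟩
  average (rhsWeight (+ res k)) (residues b)  ≡⟨ average-cong (rhsWeight-cong (≡₃-res k)) (≋-residues b) ⟨
  average (rhsWeight k) b                     ∎
  where
  open ≡-Reasoning
  digit : ∀ n → res n ∈ digits
  digit n = ∈.∈-upTo⁺ (res<3 n)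
  on-residues = All.lookup (All.lookup (All.lookup (All.lookup (All.lookup averages-agree-on-residues
                  (digit k)) (digit u₁)) (digit u₂)) (digit v₁)) (digit v₂)

-- Coefficients as weighted counts of lattice points

if-as-product : ∀ s x → (if s then x else 0K) ≡ [ s ] *K x
if-as-product true  x = sym (*K-identityˡ x)
if-as-product false x = sym (zeroˡ x)

≟M-sound : ∀ x y → (x ≟M y) ≡ true → x ≡ y
≟M-sound (a , b , c) (d , e , f) eq with a ℚP.≟ d | b ℚP.≟ e | c ℚP.≟ f
... | yes refl | yes refl | yes refl = refl
... | no _     | _        | _        with () ← eq
... | yes _    | no _     | _        with () ← eq
... | yes _    | yes _    | no _     with () ← eq

_≟P_ : DecidableEquality Point
_≟P_ = ≡-dec (≡-dec ℤ._≟_ ℤ._≟_) (≡-dec ℤ._≟_ ℤ._≟_)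

six : K
six = fromℚ (ℤ→ℚ (+ 6))

cancel-six : ∀ {x y} → six *K x ≡ six *K y → x ≡ y
cancel-six {x} {y} eq = trans (sixth-six x) (trans (cong (fromℚ (+ 1 ℚ./ 6) *K_) eq) (sym (sixth-six y)))
  where
  sixth-six : ∀ x → x ≡ fromℚ (+ 1 ℚ./ 6) *K (six *K x)
  sixth-six = solve-∀ K-ring

χ-exponent : ∀ b₁ b₂ → + 1 * (b₁ + b₂) ≡ (+ 2 * b₁ - b₂) - (b₁ - + 2 * b₂ + + 0)
χ-exponent = solve-∀ ℤ-ring

χ̄-exponent : ∀ b₁ b₂ → - + 1 * (b₁ + b₂) ≡ (b₁ - + 2 * b₂ + + 0) - (+ 2 * b₁ - b₂)
χ̄-exponent = solve-∀ ℤ-ring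

module AtMonomial (m : Mono) where

  count : (Point → K) → K
  count G = ∑[ b ∈ points (supportBound m) ] ([ monomial b ≟M m ] *K G b)

  private
    B = supportBound m

    support-bounded : ∀ b → (monomial b ≟M m) ≡ true → b ∈ points B
    support-bounded b eq = ∈-points b (bounded-support b (≟M-sound _ _ eq))

    off-support : ∀ (G : Point → K) b → (monomial b ≟M m) ≡ false → [ monomial b ≟M m ] *K G b ≡ 0K
    off-support G b eq = trans (cong (λ s → [ s ] *K G b) eq) (zeroˡ (G b))

  count-symmetry : (σ : Symmetry) (G : Point → K) → count (λ b → G (act σ b)) ≡ count G
  count-symmetry σ G = begin
    count (λ b → G (act σ b))
      ≡⟨ ∑-cong (points B) (λ b → cong (λ e → [ e ≟M m ] *K G (act σ b)) (monomial-act σ b)) ⟨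
    ∑[ b ∈ points B ] ([ monomial (act σ b) ≟M m ] *K G (act σ b))
      ≡⟨ ∑-reindex _≟P_ _≟P_ reindexing (points B) (points B) (points-unique B) (points-unique B)
                   (λ b → [ monomial b ≟M m ] *K G b) (λ b → monomial b ≟M m) (off-support G)
                   (λ b → support-bounded (act σ b))
                   (λ b _ eq → support-bounded (inverse σ b) (trans (cong (_≟M m) (monomial-inverse b)) eq)) ⟩
    count G
      ∎
    where
    open ≡-Reasoning
    reindexing : Reindexing Point Point
    reindexing = record { to = act σ ; from = inverse σ ; image = λ _ → true
                        ; to-image = λ _ → refl ; from-to = inverse-act σ ; to-from = λ b _ → act-inverse σ b }
    monomial-inverse : ∀ b → monomial (inverse σ b) ≡ monomial b
    monomial-inverse b = trans (sym (monomial-act σ (inverse σ b))) (cong monomial (act-inverse σ b))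

  count-average : ∀ G → count (average G) ≡ six *K count G
  count-average G = begin
    count (average G)
      ≡⟨ ∑-cong (points B) (λ b → ∑-*ˡ units [ monomial b ≟M m ] (λ σ → G (act σ b))) ⟩
    ∑[ b ∈ points B ] ∑[ σ ∈ units ] ([ monomial b ≟M m ] *K G (act σ b))
      ≡⟨ ∑-comm (points B) units (λ b σ → [ monomial b ≟M m ] *K G (act σ b)) ⟩
    ∑[ σ ∈ units ] count (λ b → G (act σ b))
      ≡⟨ ∑-cong units (λ σ → count-symmetry σ G) ⟩
    ∑[ σ ∈ units ] count G
      ≡⟨ six-copies (count G) ⟩
    six *K count G
      ∎
    where
    open ≡-Reasoning
    six-copies : ∀ x → x +K (x +K (x +K (x +K (x +K (x +K 0K))))) ≡ six *K x
    six-copies = solve-∀ K-ring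

  prodCoef-as-count : ∀ (r : Reindexing (O × O) Point) (S S′ : Series) (h : Point → K) R →
    (∀ β γ → expo S β +M expo S′ γ ≡ monomial (Reindexing.to r (β , γ))) →
    (∀ β γ → coef S β *K coef S′ γ ≡ h (Reindexing.to r (β , γ))) →
    (∀ b → Bounded B b → Reindexing.image r b ≡ true → Bounded R (Reindexing.from r b)) →
    prodCoefR R S S′ m ≡ count (λ b → [ Reindexing.image r b ] *K h b)
  prodCoef-as-count r S S′ h R exponent coefficient from-bounded = begin
    prodCoefR R S S′ m
      ≡⟨ ∑-cartesianProduct (box R) (box R) (λ (β , γ) → term β γ) ⟨
    ∑[ (β , γ) ∈ points R ] term β γ
      ≡⟨ ∑-cong (points R) (λ (β , γ) → trans (cong₂ (λ e c → if e ≟M m then c else 0K) (exponent β γ) (coefficient β γ))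
                                              (if-as-product (monomial (to (β , γ)) ≟M m) (h (to (β , γ))))) ⟩
    ∑[ a ∈ points R ] f (to a)
      ≡⟨ ∑-reindex _≟P_ _≟P_ r (points R) (points B) (points-unique R) (points-unique B) f (λ b → monomial b ≟M m)
                   (off-support h) (λ a → support-bounded (to a))
                   (λ b img eq → ∈-points (from b) (from-bounded b (bounded-support b (≟M-sound _ _ eq)) img)) ⟩
    ∑[ b ∈ points B ] (if image b then f b else 0K)
      ≡⟨ ∑-cong (points B) (λ b → trans (if-as-product (image b) (f b)) (swap [ image b ] [ monomial b ≟M m ] (h b))) ⟩
    count (λ b → [ image b ] *K h b)
      ∎
    where
    open ≡-Reasoning
    open Reindexing r
    term : O → O → K
    term β γ = if (expo S β +M expo S′ γ) ≟M m then coef S β *K coef S′ γ else 0K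
    f : Point → K
    f b = [ monomial b ≟M m ] *K h b
    swap : ∀ x y z → x *K (y *K z) ≡ y *K (x *K z)
    swap = solve-∀ K-ring

  count-+ : ∀ F G → count F +K count G ≡ count (λ b → F b +K G b)
  count-+ F G = sym (trans (∑-cong (points B) (λ b → *K-distribˡ [ monomial b ≟M m ] (F b) (G b)))
                        (∑-+ (points B) (λ b → [ monomial b ≟M m ] *K F b) (λ b → [ monomial b ≟M m ] *K G b)))

  count-* : ∀ w F → w *K count F ≡ count (λ b → w *K F b)
  count-* w F = trans (∑-*ˡ (points B) w (λ b → [ monomial b ≟M m ] *K F b))
                   (∑-cong (points B) (λ b → swap w [ monomial b ≟M m ] (F b)))
    where
    swap : ∀ x y z → x *K (y *K z) ≡ y *K (x *K z)
    swap = solve-∀ K-ring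

  counts-agree : ∀ k → count (lhsWeight k) ≡ count (rhsWeight k)
  counts-agree k = cancel-six (begin
    six *K count (lhsWeight k)        ≡⟨ count-average (lhsWeight k) ⟨
    count (average (lhsWeight k))     ≡⟨ ∑-cong (points B) (λ b → cong ([ monomial b ≟M m ] *K_) (averages-agree k b)) ⟩
    count (average (rhsWeight k))     ≡⟨ count-average (rhsWeight k) ⟩
    six *K count (rhsWeight k)        ∎)
    where open ≡-Reasoning

  count-combination : ∀ w₁ w₂ F₁ F₂ F₃ F₄ F₅ →
    count F₁ +K w₁ *K count F₂ +K w₂ *K count F₃ +K count F₄ +K count F₅
      ≡ count (λ b → F₁ b +K w₁ *K F₂ b +K w₂ *K F₃ b +K F₄ b +K F₅ b)
  count-combination w₁ w₂ F₁ F₂ F₃ F₄ F₅ = begin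
    count F₁ +K w₁ *K count F₂ +K w₂ *K count F₃ +K count F₄ +K count F₅
      ≡⟨ cong₂ (λ x y → count F₁ +K x +K y +K count F₄ +K count F₅) (count-* w₁ F₂) (count-* w₂ F₃) ⟩
    count F₁ +K count w₁F₂ +K count w₂F₃ +K count F₄ +K count F₅
      ≡⟨ cong (λ x → x +K count w₂F₃ +K count F₄ +K count F₅) (count-+ F₁ w₁F₂) ⟩
    count (λ b → F₁ b +K w₁F₂ b) +K count w₂F₃ +K count F₄ +K count F₅
      ≡⟨ cong (λ x → x +K count F₄ +K count F₅) (count-+ _ w₂F₃) ⟩
    count (λ b → F₁ b +K w₁F₂ b +K w₂F₃ b) +K count F₄ +K count F₅
      ≡⟨ cong (_+K count F₅) (count-+ _ F₄) ⟩
    count (λ b → F₁ b +K w₁F₂ b +K w₂F₃ b +K F₄ b) +K count F₅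
      ≡⟨ count-+ _ F₅ ⟩
    count (λ b → F₁ b +K w₁F₂ b +K w₂F₃ b +K F₄ b +K F₅ b) ∎
    where
    open ≡-Reasoning
    w₁F₂ w₂F₃ : Point → K
    w₁F₂ b = w₁ *K F₂ b
    w₂F₃ b = w₂ *K F₃ b

  module _ (k : ℤ) {R : ℕ} (R₀≤R : preimageRadius B ∣ k ∣ ≤ R) where

    lhs-as-count : three *K prodCoefR R (cS k) (substExp σ-sq (cS k)) m ≡ count (lhsWeight k)
    lhs-as-count = begin
      three *K prodCoefR R (cS k) (substExp σ-sq (cS k)) m
        ≡⟨ cong (three *K_) (prodCoef-as-count (lhsReindexing k) (cS k) (substExp σ-sq (cS k)) (λ _ → 1K) R
                               (monomial-lhsPoint k) (λ _ _ → refl)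
                               (λ b bounded img → lhsPreimage-bounded R₀≤R b ℕP.≤-refl bounded img)) ⟩
      three *K count (λ b → [ lhsImage k b ] *K 1K)
        ≡⟨ count-* three _ ⟩
      count (λ b → three *K ([ lhsImage k b ] *K 1K))
        ≡⟨ ∑-cong (points B) (λ b → cong ([ monomial b ≟M m ] *K_) (drop-one three [ lhsImage k b ])) ⟩
      count (lhsWeight k)
        ∎
      where
      open ≡-Reasoning
      drop-one : ∀ x y → x *K (y *K 1K) ≡ x *K y
      drop-one = solve-∀ K-ring

    private
      rhs-term : ∀ j j′ f f′ (h : Point → K) → ∣ j ∣ ≤ 1 → ∣ j′ ∣ ≤ 1 →
        (∀ β γ → f β *K f′ γ ≡ h (rhsPoint j j′ (β , γ))) →
        prodCoefR R (substExp σ-wz (theta (fromℚ (ℤ→ℚ j) *K λK⁻¹) f)) (substExp σ-sq11 (theta (fromℚ (ℤ→ℚ j′) *K λK⁻¹) f′)) m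
          ≡ count (λ b → [ Reindexing.image (rhsReindexing j j′) b ] *K h b)
      rhs-term j j′ f f′ h ∣j∣≤1 ∣j′∣≤1 coefficient =
        prodCoef-as-count (rhsReindexing j j′) (substExp σ-wz (theta (fromℚ (ℤ→ℚ j) *K λK⁻¹) f))
          (substExp σ-sq11 (theta (fromℚ (ℤ→ℚ j′) *K λK⁻¹) f′)) h R (monomial-rhsPoint j j′ f f′) coefficient from-bounded
        where
        from-bounded : ∀ b → Bounded B b → Reindexing.image (rhsReindexing j j′) b ≡ true →
                       Bounded R (Reindexing.from (rhsReindexing j j′) b)
        from-bounded ((u₁ , u₂) , (v₁ , v₂)) (∣u₁∣≤ , ∣u₂∣≤ , ∣v₁∣≤ , ∣v₂∣≤) img =
          let (x₁ , x₂) = divλ-bounded R₀≤R (u₁ , u₂) ∣j∣≤1 ∣u₁∣≤ ∣u₂∣≤ (proj₁ (∧-true img))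
              (y₁ , y₂) = divλ-bounded R₀≤R (v₁ , v₂) ∣j′∣≤1 ∣v₁∣≤ ∣v₂∣≤ (proj₂ (∧-true img))
          in x₁ , x₂ , y₁ , y₂

    rhs-as-count :
      prodCoefR R (substExp σ-wz aS) (substExp σ-sq11 aS) m
      +K (ωpow k *K prodCoefR R (substExp σ-wz (bS (+ 1))) (substExp σ-sq11 (bS (+ 1))) m)
      +K (ωpow (- k) *K prodCoefR R (substExp σ-wz (bS (- (+ 1)))) (substExp σ-sq11 (bS (+ 1))) m)
      +K prodCoefR R (substExp σ-wz (cS (+ 1))) (substExp σ-sq11 (cS (+ 1))) m
      +K prodCoefR R (substExp σ-wz (cS (- (+ 1)))) (substExp σ-sq11 (cS (+ 1))) m
      ≡ count (rhsWeight k)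
    rhs-as-count = begin
      _ ≡⟨ cong₂ _+K_ (cong₂ _+K_ (cong₂ (λ x y → x +K ωpow (- k) *K y)
                                         (cong₂ (λ x y → x +K ωpow k *K y) a b₁) b₋) c₁) c₋ ⟩
      count (λ b → [ image₀₀ b ] *K 1K) +K ωpow k *K count (λ b → [ image₀₀ b ] *K χ-pair b)
        +K ωpow (- k) *K count (λ b → [ image₀₀ b ] *K χ̄-pair b) +K count (λ b → [ image₁₁ b ] *K 1K) +K count (λ b → [ image₋₁₁ b ] *K 1K)
        ≡⟨ count-combination (ωpow k) (ωpow (- k)) _ _ _ _ _ ⟩
      count (λ b → [ image₀₀ b ] *K 1K +K ωpow k *K ([ image₀₀ b ] *K χ-pair b) +K ωpow (- k) *K ([ image₀₀ b ] *K χ̄-pair b)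
                +K [ image₁₁ b ] *K 1K +K [ image₋₁₁ b ] *K 1K)
        ≡⟨ ∑-cong (points B) (λ b → cong ([ monomial b ≟M m ] *K_)
             (collect [ image₀₀ b ] [ image₁₁ b ] [ image₋₁₁ b ] (ωpow k) (ωpow (- k)) (χ-pair b) (χ̄-pair b))) ⟩
      count (rhsWeight k) ∎
      where
      open ≡-Reasoning
      image₀₀ = Reindexing.image (rhsReindexing (+ 0) (+ 0))
      image₁₁ = Reindexing.image (rhsReindexing (+ 1) (+ 1))
      image₋₁₁ = Reindexing.image (rhsReindexing (- + 1) (+ 1))
      a = rhs-term (+ 0) (+ 0) (λ _ → 1K) (λ _ → 1K) (λ _ → 1K) z≤n z≤n (λ _ _ → refl)
      b₁ = rhs-term (+ 0) (+ 0) (χ^ (+ 1)) (χ^ (+ 1)) χ-pair z≤n z≤n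
             (λ (b₁ , b₂) (g₁ , g₂) → cong₂ _*K_ (cong ωpow (χ-exponent b₁ b₂)) (cong ωpow (χ-exponent g₁ g₂)))
      b₋ = rhs-term (+ 0) (+ 0) (χ^ (- + 1)) (χ^ (+ 1)) χ̄-pair z≤n z≤n
             (λ (b₁ , b₂) (g₁ , g₂) → cong₂ _*K_ (cong ωpow (χ̄-exponent b₁ b₂)) (cong ωpow (χ-exponent g₁ g₂)))
      c₁ = rhs-term (+ 1) (+ 1) (λ _ → 1K) (λ _ → 1K) (λ _ → 1K) ℕP.≤-refl ℕP.≤-refl (λ _ _ → refl)
      c₋ = rhs-term (- + 1) (+ 1) (λ _ → 1K) (λ _ → 1K) (λ _ → 1K) ℕP.≤-refl ℕP.≤-refl (λ _ _ → refl)
      collect : ∀ i₀ i₁ i₋ w₁ w₂ x y →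
        i₀ *K 1K +K w₁ *K (i₀ *K x) +K w₂ *K (i₀ *K y) +K i₁ *K 1K +K i₋ *K 1K ≡ i₀ *K (1K +K w₁ *K x +K w₂ *K y) +K i₁ +K i₋
      collect = solve-∀ K-ring

coefficient-identity : (k : ℤ) → (m : Mono) → ∃ λ R₀ → (R : ℕ) → R₀ ≤ R →
  fromℚ (ℤ→ℚ (+ 3)) *K prodCoefR R (cS k) (substExp σ-sq (cS k)) m
    ≡ prodCoefR R (substExp σ-wz aS) (substExp σ-sq11 aS) m
      +K (ωpow k *K prodCoefR R (substExp σ-wz (bS (+ 1))) (substExp σ-sq11 (bS (+ 1))) m)
      +K (ωpow (- k) *K prodCoefR R (substExp σ-wz (bS (- (+ 1)))) (substExp σ-sq11 (bS (+ 1))) m)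
      +K prodCoefR R (substExp σ-wz (cS (+ 1))) (substExp σ-sq11 (cS (+ 1))) m
      +K prodCoefR R (substExp σ-wz (cS (- (+ 1)))) (substExp σ-sq11 (cS (+ 1))) m
coefficient-identity k m = preimageRadius (supportBound m) ∣ k ∣ , λ R R₀≤R →
  trans (lhs-as-count k R₀≤R) (trans (counts-agree k) (sym (rhs-as-count k R₀≤R)))
  where open AtMonomial m

theorem2 :
    ((k : ℤ) → (m : Mono) → ∃ λ R₀ → (R : ℕ) → R₀ ≤ R →
      fromℚ (ℤ→ℚ (+ 3)) *K prodCoefR R (cS k) (substExp σ-sq (cS k)) m
        ≡ prodCoefR R (substExp σ-wz aS) (substExp σ-sq11 aS) m
          +K (ωpow k *K prodCoefR R (substExp σ-wz (bS (+ 1))) (substExp σ-sq11 (bS (+ 1))) m)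
          +K (ωpow (- k) *K prodCoefR R (substExp σ-wz (bS (- (+ 1)))) (substExp σ-sq11 (bS (+ 1))) m)
          +K prodCoefR R (substExp σ-wz (cS (+ 1))) (substExp σ-sq11 (cS (+ 1))) m
          +K prodCoefR R (substExp σ-wz (cS (- (+ 1)))) (substExp σ-sq11 (cS (+ 1))) m)
    × ((m : Mono) → ∃ λ R₀ → (R : ℕ) → R₀ ≤ R →
      fromℚ (ℤ→ℚ (+ 3)) *K prodCoefR R aS (substExp σ-sq aS) m
        ≡ prodCoefR R (substExp σ-wz aS) (substExp σ-sq11 aS) m
          +K prodCoefR R (substExp σ-wz (bS (+ 1))) (substExp σ-sq11 (bS (+ 1))) m
          +K prodCoefR R (substExp σ-wz (bS (- (+ 1)))) (substExp σ-sq11 (bS (+ 1))) m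
          +K prodCoefR R (substExp σ-wz (cS (+ 1))) (substExp σ-sq11 (cS (+ 1))) m
          +K prodCoefR R (substExp σ-wz (cS (- (+ 1)))) (substExp σ-sq11 (cS (+ 1))) m)
theorem2 = coefficient-identity , λ m →
  let (R₀ , identity) = coefficient-identity (+ 0) m
      rhs : ℕ → Series → Series → K
      rhs R S S′ = prodCoefR R (substExp σ-wz S) (substExp σ-sq11 S′) m
  in R₀ , λ R R₀≤R → trans (identity R R₀≤R)
            (drop-units (rhs R aS aS) (rhs R (bS (+ 1)) (bS (+ 1))) (rhs R (bS (- (+ 1))) (bS (+ 1)))
                        (rhs R (cS (+ 1)) (cS (+ 1))) (rhs R (cS (- (+ 1))) (cS (+ 1))))
  where
  drop-units : ∀ a b c d e → a +K 1K *K b +K 1K *K c +K d +K e ≡ a +K b +K c +K d +K e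
  drop-units = solve-∀ K-ring
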